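{- Let $N\ge1$ and let $q,\gamma,s_0,\xi_0$ be generic complex parameters with $s_0\xi_0\gamma\ne0$. For variables $u_1,\ldots,u_N,v_1,\ldots,v_N$ define \[\mathsf{M}_i(v)=\xi_0^{2i-N}v^{N-i-1}\Big\{(1-\gamma s_0\xi_0^{ -1}v)(v\xi_0^{ -1}-\gamma s_0)\prod_{l=1}^N\frac{1-qvu_l}{1-vu_l}-\gamma q^{N-i}(1-s_0\xi_0^{ -1}v)(qv\xi_0^{ -1}-s_0)\Big\},\quad i=1,\ldots,N,\] and \[\mathscr{M}_N^\gamma(u_1,\ldots,u_N\mid v_1,\ldots,v_N;s_0)=\prod_{i,j=1}^N(1-u_iv_j)\,\frac{\det\big[\mathsf{M}_i(v_j)\big]_{i,j=1}^N}{\prod_{1\le i<j\le N}(v_i-v_j)}.\] Then \begin{align*} &\mathscr{M}_N^\gamma\big((s_0\xi_0\gamma)^{ -1},q(s_0\xi_0\gamma)^{ -1},\ldots,q^{N-1}(s_0\xi_0\gamma)^{ -1}\mid v_1,\ldots,v_N;s_0\big)\\ &\quad=q^{N^2}\prod_{i,j=1}^N\Big(1-v_i\frac{q^{j-1}}{s_0\xi_0\gamma}\Big)\prod_{j=1}^N(1-\gamma q^{ -j+1})(1-s_0^2\gamma q^{ -j}). \end{align*} -}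

module Defs where

open import Level using (Level; _⊔_) renaming (suc to lsuc)
open import Algebra.Bundles using (CommutativeRing)
open import Data.Nat as ℕ using (ℕ; zero; suc; _∸_)
open import Data.Integer as ℤ using (ℤ; +_; -[1+_])
open import Data.Fin as Fin using (Fin; toℕ; punchIn; _<?_)
open import Relation.Nullary using (¬_; does)
open import Data.Bool using (if_then_else_)

-- A field: a commutative ring with a total inverse function which is a
-- genuine multiplicative inverse on nonzero elements, and 1 ≠ 0.
-- (The value of 0⁻¹ is irrelevant; it is never used under the hypotheses.)
record Field (c ℓ : Level) : Set (lsuc (c ⊔ ℓ)) where
  field
    commutativeRing : CommutativeRing c ℓ
  open CommutativeRing commutativeRing public
  infix 8 _⁻¹
  field
    _⁻¹     : Carrier → Carrier
    inverse : ∀ x → ¬ (x ≈ 0#) → (x * (x ⁻¹)) ≈ 1#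
    1≉0     : ¬ (1# ≈ 0#)

module FieldDefs {c ℓ : Level} (F : Field c ℓ) where
  open Field F public

  _^ℕ_ : Carrier → ℕ → Carrier
  x ^ℕ zero  = 1#
  x ^ℕ suc n = x * (x ^ℕ n)

  _^ℤ_ : Carrier → ℤ → Carrier
  x ^ℤ (+ n)     = x ^ℕ n
  x ^ℤ -[1+ n ]  = (x ⁻¹) ^ℕ suc n

  _÷_ : Carrier → Carrier → Carrier
  x ÷ y = x * (y ⁻¹)

  Σ[_] : (n : ℕ) → (Fin n → Carrier) → Carrier
  Σ[ zero  ] f = 0#
  Σ[ suc n ] f = f Fin.zero + Σ[ n ] (λ i → f (Fin.suc i))

  Π[_] : (n : ℕ) → (Fin n → Carrier) → Carrier
  Π[ zero  ] f = 1#
  Π[ suc n ] f = f Fin.zero * Π[ n ] (λ i → f (Fin.suc i))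

  Π<[_] : (n : ℕ) → (Fin n → Fin n → Carrier) → Carrier
  Π<[ n ] f = Π[ n ] λ i → Π[ n ] λ j → if does (i <? j) then f i j else 1#

  det : (n : ℕ) → (Fin n → Fin n → Carrier) → Carrier
  det zero    A = 1#
  det (suc n) A = Σ[ suc n ] λ j →
    (((- 1#) ^ℕ toℕ j) * A Fin.zero j) * det n (λ i k → A (Fin.suc i) (punchIn j k))

  -- the entries M_i(v), for i ∈ Fin N standing for the index toℕ i + 1
  M : (N : ℕ) (q γ s₀ ξ₀ : Carrier) (u : Fin N → Carrier) → Fin N → Carrier → Carrier
  M N q γ s₀ ξ₀ u i v =
    ((ξ₀ ^ℤ ((+ (2 ℕ.* ι)) ℤ.- (+ N))) * (v ^ℤ (((+ N) ℤ.- (+ ι)) ℤ.- (+ 1))))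
    * ( (((1# - ((γ * s₀) * (ξ₀ ⁻¹)) * v) * ((v * (ξ₀ ⁻¹)) - (γ * s₀)))
          * Π[ N ] (λ l → (1# - (q * v) * u l) ÷ (1# - v * u l)))
      - (((γ * (q ^ℕ (N ∸ ι))) * (1# - (s₀ * (ξ₀ ⁻¹)) * v)) * (((q * v) * (ξ₀ ⁻¹)) - s₀)) )
    where ι = suc (toℕ i)

  𝓜 : (N : ℕ) (q γ s₀ ξ₀ : Carrier) (u v : Fin N → Carrier) → Carrier
  𝓜 N q γ s₀ ξ₀ u v =
    (Π[ N ] λ i → Π[ N ] λ j → 1# - u i * v j)
    * (det N (λ i j → M N q γ s₀ ξ₀ u i (v j)) ÷ Π<[ N ] (λ i j → v i - v j))

module Submission where

-- Put y = v / ξ₀. At uₗ = qˡ / (s₀ ξ₀ γ) the product over l in Mᵢ(v) telescopes, and after scaling the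
-- rows by powers of ξ₀ and the columns by y, row i becomes y^k (Φ(y) + q^k Ψ(y)) with k = N - i and Φ, Ψ
-- quadratic. Left multiplication by the triangular matrix U whose rows are the coefficient vectors of
-- P_k(z) = (s₀ - q z) ⋯ (s₀ - qᵏ z) turns row k into Φ(y) P_k(y) + Ψ(y) P_k(q y) = y (μ_k P_k(y) + ν_k P_{k+1}(y)),
-- that is, U · (scaled matrix) = B · U · V · diag(y) with B lower bidiagonal with diagonal μ and V the
-- Vandermonde matrix of y. Cancelling det U leaves ∏ μ times the Vandermonde product ∏_{i<j} (vᵢ - vⱼ), and
-- ∏ μ is the stated product of q-factors.

open import Defs
open import Level using (Level)
open import Data.Nat using (ℕ; _≤_) renaming (_*_ to _ℕ*_; _+_ to _ℕ+_)
open import Data.Integer using (+_) renaming (-_ to ℤ-_)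
open import Data.Fin using (Fin; toℕ)
open import Relation.Nullary using (¬_)
open import Relation.Binary.PropositionalEquality using (_≢_)

open import Algebra.Bundles using (CommutativeRing)
open import Data.Nat as ℕ using (zero; suc; _∸_; _<_)
import Data.Nat.Properties as ℕ
open import Data.Integer as ℤ using (ℤ; -[1+_]; _⊖_; _◃_; sign; ∣_∣)
import Data.Integer.Properties as ℤ
open import Data.Sign as Sign using (Sign)
open import Data.Maybe using (Maybe; just; nothing)
open import Relation.Nullary using (yes; no)
open import Relation.Binary.PropositionalEquality as ≡ using (_≡_)
open import Function using (_∘_)
open import Data.Vec.Functional using ([]; _∷_)

-- With coefficients in ℤ the normaliser decides constant arithmetic such as 1 - 1 = 0 by computation, which
-- coefficients taken from an arbitrary ring cannot do.
module ℤ-CoefficientSolver {c ℓ : Level} (R : CommutativeRing c ℓ) where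
  open CommutativeRing R
  open import Algebra.Properties.Ring ring using (-‿involutive; -1*x≈-x; -‿+-comm; -0#≈0#)
  open import Algebra.Properties.Semiring.Mult.TCOptimised semiring using (_×_; 1+×; ×-homo-+; ×1-homo-*)
  open import Algebra.Solver.Ring.AlmostCommutativeRing
    using (fromCommutativeRing; _-Raw-AlmostCommutative⟶_)
  open import Algebra.Properties.CommutativeSemigroup *-commutativeSemigroup using (interchange)
  open import Relation.Binary.Reasoning.Setoid setoid

  ⟦_⟧ℤ : ℤ → Carrier
  ⟦ + n ⟧ℤ     = n × 1#
  ⟦ -[1+ n ] ⟧ℤ = - (suc n × 1#)

  ⊖-homo : ∀ m n → ⟦ m ⊖ n ⟧ℤ ≈ m × 1# - n × 1#
  ⊖-homo zero    zero    = sym (trans (+-congˡ -0#≈0#) (+-identityʳ _))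
  ⊖-homo (suc m) zero    = sym (trans (+-congˡ -0#≈0#) (+-identityʳ _))
  ⊖-homo zero    (suc n) = sym (+-identityˡ _)
  ⊖-homo (suc m) (suc n) = begin
    ⟦ suc m ⊖ suc n ⟧ℤ              ≡⟨ ≡.cong ⟦_⟧ℤ (ℤ.[1+m]⊖[1+n]≡m⊖n m n) ⟩
    ⟦ m ⊖ n ⟧ℤ                      ≈⟨ ⊖-homo m n ⟩
    m × 1# - n × 1#                 ≈⟨ cancel-1 (m × 1#) (n × 1#) ⟩
    (1# + m × 1#) - (1# + n × 1#)   ≈⟨ +-cong (1+× m 1#) (-‿cong (1+× n 1#)) ⟨
    suc m × 1# - suc n × 1#         ∎
    where
    cancel-1 : ∀ a b → a - b ≈ (1# + a) - (1# + b)
    cancel-1 a b = begin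
      a - b                   ≈⟨ +-identityˡ _ ⟨
      0# + (a - b)            ≈⟨ +-congʳ (-‿inverseʳ 1#) ⟨
      (1# - 1#) + (a - b)     ≈⟨ +-assoc _ _ _ ⟩
      1# + (- 1# + (a - b))   ≈⟨ +-congˡ (+-assoc _ _ _) ⟨
      1# + ((- 1# + a) - b)   ≈⟨ +-congˡ (+-congʳ (+-comm _ _)) ⟩
      1# + ((a - 1#) - b)     ≈⟨ +-congˡ (+-assoc _ _ _) ⟩
      1# + (a + (- 1# - b))   ≈⟨ +-assoc _ _ _ ⟨
      (1# + a) + (- 1# - b)   ≈⟨ +-congˡ (-‿+-comm _ _) ⟩
      (1# + a) - (1# + b)     ∎

  +-homo : ∀ i j → ⟦ i ℤ.+ j ⟧ℤ ≈ ⟦ i ⟧ℤ + ⟦ j ⟧ℤ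
  +-homo (+ m)     (+ n)     = ×-homo-+ 1# m n
  +-homo (+ m)     -[1+ n ]  = ⊖-homo m (suc n)
  +-homo -[1+ m ]  (+ n)     = trans (⊖-homo n (suc m)) (+-comm _ _)
  +-homo -[1+ m ]  -[1+ n ]  = begin
    - (suc (suc (m ℕ.+ n)) × 1#)        ≡⟨ ≡.cong (λ k → - (suc k × 1#)) (ℕ.+-suc m n) ⟨
    - (suc (m ℕ.+ suc n) × 1#)          ≈⟨ -‿cong (×-homo-+ 1# (suc m) (suc n)) ⟩
    - (suc m × 1# + suc n × 1#)         ≈⟨ -‿+-comm _ _ ⟨
    - (suc m × 1#) + - (suc n × 1#)     ∎

  sign-homo : Sign → Carrier
  sign-homo Sign.+ = 1#
  sign-homo Sign.- = - 1#

  ◃-homo : ∀ s n → ⟦ s ◃ n ⟧ℤ ≈ sign-homo s * (n × 1#)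
  ◃-homo s      zero    = sym (zeroʳ _)
  ◃-homo Sign.+ (suc n) = sym (*-identityˡ _)
  ◃-homo Sign.- (suc n) = sym (-1*x≈-x _)

  sign-homo-* : ∀ s t → sign-homo (s Sign.* t) ≈ sign-homo s * sign-homo t
  sign-homo-* Sign.+ t      = sym (*-identityˡ _)
  sign-homo-* Sign.- Sign.+ = sym (*-identityʳ _)
  sign-homo-* Sign.- Sign.- = begin
    1#             ≈⟨ -‿involutive 1# ⟨
    - - 1#         ≈⟨ -1*x≈-x (- 1#) ⟨
    - 1# * - 1#    ∎

  *-homo : ∀ i j → ⟦ i ℤ.* j ⟧ℤ ≈ ⟦ i ⟧ℤ * ⟦ j ⟧ℤ
  *-homo i j = begin
    ⟦ (sign i Sign.* sign j) ◃ (∣ i ∣ ℕ.* ∣ j ∣) ⟧ℤ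
      ≈⟨ ◃-homo (sign i Sign.* sign j) (∣ i ∣ ℕ.* ∣ j ∣) ⟩
    sign-homo (sign i Sign.* sign j) * ((∣ i ∣ ℕ.* ∣ j ∣) × 1#)
      ≈⟨ *-cong (sign-homo-* (sign i) (sign j)) (×1-homo-* ∣ i ∣ ∣ j ∣) ⟩
    (sign-homo (sign i) * sign-homo (sign j)) * (∣ i ∣ × 1# * ∣ j ∣ × 1#)
      ≈⟨ interchange _ _ _ _ ⟩
    (sign-homo (sign i) * ∣ i ∣ × 1#) * (sign-homo (sign j) * ∣ j ∣ × 1#)
      ≈⟨ *-cong (sign-decomposition i) (sign-decomposition j) ⟨
    ⟦ i ⟧ℤ * ⟦ j ⟧ℤ ∎
    where
    sign-decomposition : ∀ k → ⟦ k ⟧ℤ ≈ sign-homo (sign k) * (∣ k ∣ × 1#)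
    sign-decomposition k = begin
      ⟦ k ⟧ℤ                  ≡⟨ ≡.cong ⟦_⟧ℤ (ℤ.◃-inverse k) ⟨
      ⟦ sign k ◃ ∣ k ∣ ⟧ℤ     ≈⟨ ◃-homo (sign k) ∣ k ∣ ⟩
      sign-homo (sign k) * (∣ k ∣ × 1#) ∎

  -‿homo : ∀ i → ⟦ ℤ.- i ⟧ℤ ≈ - ⟦ i ⟧ℤ
  -‿homo -[1+ n ]    = sym (-‿involutive _)
  -‿homo (+ zero)    = sym -0#≈0#
  -‿homo (+ suc n)   = refl

  homomorphism : ℤ.+-*-rawRing -Raw-AlmostCommutative⟶ fromCommutativeRing R
  homomorphism = record
    { ⟦_⟧ = ⟦_⟧ℤ ; +-homo = +-homo ; *-homo = *-homo ; -‿homo = -‿homo ; 0-homo = refl ; 1-homo = refl }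

  ⟦⟧ℤ-≟ : ∀ i j → Maybe (⟦ i ⟧ℤ ≈ ⟦ j ⟧ℤ)
  ⟦⟧ℤ-≟ i j with i ℤ.≟ j
  ... | yes ≡.refl = just refl
  ... | no _       = nothing

  open import Algebra.Solver.Ring ℤ.+-*-rawRing (fromCommutativeRing R) homomorphism ⟦⟧ℤ-≟ public


module _ {c ℓ : Level} (F : Field c ℓ) where

  open FieldDefs F hiding (zero)
  open import Data.Fin as Fin using (zero; suc; punchIn; inject₁; fromℕ; fromℕ<; _<?_)
  import Data.Fin.Properties as Fin
  open import Data.Bool using (Bool; true; false; if_then_else_)
  open import Data.Product using (_,_; proj₁; proj₂)
  open import Data.Empty using (⊥-elim)
  open import Relation.Nullary using (Dec; does)
  open import Algebra.Properties.Ring ring using (-‿involutive; -‿distribʳ-*; -‿+-comm; -0#≈0#)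
  open import Algebra.Properties.CommutativeSemigroup *-commutativeSemigroup
    using (interchange; x∙yz≈y∙xz; xy∙z≈y∙xz)
  open import Relation.Binary.Reasoning.Setoid setoid
  open ℤ-CoefficientSolver commutativeRing using (solve; _:+_; _:*_; _:-_; :-_; _:=_; con)

  Σ-cong : ∀ n {f g : Fin n → Carrier} → (∀ i → f i ≈ g i) → Σ[ n ] f ≈ Σ[ n ] g
  Σ-cong zero    f≈g = refl
  Σ-cong (suc n) f≈g = +-cong (f≈g zero) (Σ-cong n (f≈g ∘ suc))

  Π-cong : ∀ n {f g : Fin n → Carrier} → (∀ i → f i ≈ g i) → Π[ n ] f ≈ Π[ n ] g
  Π-cong zero    f≈g = refl
  Π-cong (suc n) f≈g = *-cong (f≈g zero) (Π-cong n (f≈g ∘ suc))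

  Σ-zero : ∀ n {f : Fin n → Carrier} → (∀ i → f i ≈ 0#) → Σ[ n ] f ≈ 0#
  Σ-zero zero    f≈0 = refl
  Σ-zero (suc n) f≈0 = trans (+-cong (f≈0 zero) (Σ-zero n (f≈0 ∘ suc))) (+-identityˡ _)

  Π-one : ∀ n {f : Fin n → Carrier} → (∀ i → f i ≈ 1#) → Π[ n ] f ≈ 1#
  Π-one zero    f≈1 = refl
  Π-one (suc n) f≈1 = trans (*-cong (f≈1 zero) (Π-one n (f≈1 ∘ suc))) (*-identityˡ _)

  Σ-distrib-+ : ∀ n (f g : Fin n → Carrier) → Σ[ n ] (λ i → f i + g i) ≈ Σ[ n ] f + Σ[ n ] g
  Σ-distrib-+ zero    f g = sym (+-identityˡ _)
  Σ-distrib-+ (suc n) f g = trans (+-congˡ (Σ-distrib-+ n (f ∘ suc) (g ∘ suc))) (+-interchange _ _ _ _)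
    where open import Algebra.Properties.CommutativeSemigroup +-commutativeSemigroup
            renaming (interchange to +-interchange)

  -‿distrib-Σ : ∀ n (f : Fin n → Carrier) → - Σ[ n ] f ≈ Σ[ n ] (λ i → - f i)
  -‿distrib-Σ zero    f = -0#≈0#
  -‿distrib-Σ (suc n) f = trans (sym (-‿+-comm _ _)) (+-congˡ (-‿distrib-Σ n (f ∘ suc)))

  *-distribˡ-Σ : ∀ n a (f : Fin n → Carrier) → a * Σ[ n ] f ≈ Σ[ n ] (λ i → a * f i)
  *-distribˡ-Σ zero    a f = zeroʳ a
  *-distribˡ-Σ (suc n) a f = trans (distribˡ _ _ _) (+-congˡ (*-distribˡ-Σ n a (f ∘ suc)))

  *-distribʳ-Σ : ∀ n a (f : Fin n → Carrier) → Σ[ n ] f * a ≈ Σ[ n ] (λ i → f i * a)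
  *-distribʳ-Σ zero    a f = zeroˡ a
  *-distribʳ-Σ (suc n) a f = trans (distribʳ _ _ _) (+-congˡ (*-distribʳ-Σ n a (f ∘ suc)))

  Σ-comm : ∀ m n (f : Fin m → Fin n → Carrier) →
           Σ[ m ] (λ i → Σ[ n ] (f i)) ≈ Σ[ n ] (λ j → Σ[ m ] (λ i → f i j))
  Σ-comm zero    n f = sym (Σ-zero n (λ _ → refl))
  Σ-comm (suc m) n f = trans (+-congˡ (Σ-comm m n (f ∘ suc))) (sym (Σ-distrib-+ n _ _))

  Π-distrib-* : ∀ n (f g : Fin n → Carrier) → Π[ n ] (λ i → f i * g i) ≈ Π[ n ] f * Π[ n ] g
  Π-distrib-* zero    f g = sym (*-identityˡ _)
  Π-distrib-* (suc n) f g = trans (*-congˡ (Π-distrib-* n (f ∘ suc) (g ∘ suc))) (interchange _ _ _ _)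

  Π-comm : ∀ m n (f : Fin m → Fin n → Carrier) →
           Π[ m ] (λ i → Π[ n ] (f i)) ≈ Π[ n ] (λ j → Π[ m ] (λ i → f i j))
  Π-comm zero    n f = sym (Π-one n (λ _ → refl))
  Π-comm (suc m) n f = trans (*-congˡ (Π-comm m n (f ∘ suc))) (sym (Π-distrib-* n _ _))

  Π<-suc : ∀ n (f : Fin (suc n) → Fin (suc n) → Carrier) →
           Π<[ suc n ] f ≈ Π[ n ] (λ j → f zero (suc j)) * Π<[ n ] (λ i j → f (suc i) (suc j))
  Π<-suc n f = *-cong (*-identityˡ _) (Π-cong n (λ i → *-identityˡ _))

  Π<-cong : ∀ n {f g : Fin n → Fin n → Carrier} → (∀ i j → f i j ≈ g i j) → Π<[ n ] f ≈ Π<[ n ] g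
  Π<-cong n f≈g = Π-cong n (λ i → Π-cong n (λ j → if-cong (does (i <? j)) (f≈g i j)))
    where
    if-cong : ∀ {a b} (t : Bool) → a ≈ b → (if t then a else 1#) ≈ (if t then b else 1#)
    if-cong true  a≈b = a≈b
    if-cong false a≈b = refl

  Π<-distrib-* : ∀ n (f g : Fin n → Fin n → Carrier) →
                 Π<[ n ] (λ i j → f i j * g i j) ≈ Π<[ n ] f * Π<[ n ] g
  Π<-distrib-* n f g =
    trans (Π-cong n (λ i → trans (Π-cong n (λ j → if-distrib (does (i <? j)))) (Π-distrib-* n _ _)))
          (Π-distrib-* n _ _)
    where
    if-distrib : ∀ {a b} (t : Bool) →
                 (if t then a * b else 1#) ≈ (if t then a else 1#) * (if t then b else 1#)
    if-distrib true  = refl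
    if-distrib false = sym (*-identityˡ _)

  Π-powers-cancel-Π< : ∀ n x w → x * w ≈ 1# → Π[ n ] (λ r → x ^ℕ toℕ r) * Π<[ n ] (λ _ _ → w) ≈ 1#
  Π-powers-cancel-Π< zero    x w xw≈1 = *-identityˡ _
  Π-powers-cancel-Π< (suc n) x w xw≈1 = begin
    (1# * Π[ n ] (λ r → x * x ^ℕ toℕ r)) * Π<[ suc n ] (λ _ _ → w)
      ≈⟨ *-cong (trans (*-identityˡ _) (Π-distrib-* n _ _)) (Π<-suc n (λ _ _ → w)) ⟩
    (Π[ n ] (λ _ → x) * Π[ n ] (λ r → x ^ℕ toℕ r)) * (Π[ n ] (λ _ → w) * Π<[ n ] (λ _ _ → w))
      ≈⟨ interchange _ _ _ _ ⟩
    (Π[ n ] (λ _ → x) * Π[ n ] (λ _ → w)) * (Π[ n ] (λ r → x ^ℕ toℕ r) * Π<[ n ] (λ _ _ → w))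
      ≈⟨ *-cong (trans (sym (Π-distrib-* n _ _)) (Π-one n (λ _ → xw≈1))) (Π-powers-cancel-Π< n x w xw≈1) ⟩
    1# * 1#
      ≈⟨ *-identityˡ _ ⟩
    1# ∎

  ⁻¹-inverseˡ : ∀ x → ¬ x ≈ 0# → x ⁻¹ * x ≈ 1#
  ⁻¹-inverseˡ x x≉0 = trans (*-comm _ _) (inverse x x≉0)

  *-cancelˡ : ∀ {z a b} → ¬ z ≈ 0# → z * a ≈ z * b → a ≈ b
  *-cancelˡ {z} {a} {b} z≉0 za≈zb = begin
    a                ≈⟨ *-identityˡ a ⟨
    1# * a           ≈⟨ *-congʳ (⁻¹-inverseˡ z z≉0) ⟨
    (z ⁻¹ * z) * a   ≈⟨ *-assoc _ _ _ ⟩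
    z ⁻¹ * (z * a)   ≈⟨ *-congˡ za≈zb ⟩
    z ⁻¹ * (z * b)   ≈⟨ *-assoc _ _ _ ⟨
    (z ⁻¹ * z) * b   ≈⟨ *-congʳ (⁻¹-inverseˡ z z≉0) ⟩
    1# * b           ≈⟨ *-identityˡ b ⟩
    b                ∎

  *-÷-cancelʳ : ∀ x {y} → ¬ y ≈ 0# → (x * y) ÷ y ≈ x
  *-÷-cancelʳ x {y} y≉0 = trans (*-assoc _ _ _) (trans (*-congˡ (inverse y y≉0)) (*-identityʳ x))

  *-nonzero : ∀ {x y} → ¬ x ≈ 0# → ¬ y ≈ 0# → ¬ x * y ≈ 0#
  *-nonzero {x} {y} x≉0 y≉0 xy≈0 = y≉0 (*-cancelˡ x≉0 (trans xy≈0 (sym (zeroʳ x))))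

  ≈-nonzero : ∀ {a b} → a ≈ b → ¬ b ≈ 0# → ¬ a ≈ 0#
  ≈-nonzero a≈b b≉0 a≈0 = b≉0 (trans (sym a≈b) a≈0)

  -‿nonzero : ∀ {x} → ¬ x ≈ 0# → ¬ - x ≈ 0#
  -‿nonzero {x} x≉0 -x≈0 = x≉0 (trans (sym (-‿involutive x)) (trans (-‿cong -x≈0) -0#≈0#))

  ⁻¹-nonzero : ∀ {x} → ¬ x ≈ 0# → ¬ x ⁻¹ ≈ 0#
  ⁻¹-nonzero {x} x≉0 x⁻¹≈0 = 1≉0 (trans (sym (inverse x x≉0)) (trans (*-congˡ x⁻¹≈0) (zeroʳ _)))

  ^ℕ-nonzero : ∀ {x} n → ¬ x ≈ 0# → ¬ x ^ℕ n ≈ 0#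
  ^ℕ-nonzero zero    x≉0 = 1≉0
  ^ℕ-nonzero (suc n) x≉0 = *-nonzero x≉0 (^ℕ-nonzero n x≉0)

  Π-nonzero : ∀ n {f : Fin n → Carrier} → (∀ i → ¬ f i ≈ 0#) → ¬ Π[ n ] f ≈ 0#
  Π-nonzero zero    f≉0 = 1≉0
  Π-nonzero (suc n) f≉0 = *-nonzero (f≉0 zero) (Π-nonzero n (f≉0 ∘ suc))

  Π<-nonzero : ∀ n (f : Fin n → Fin n → Carrier) → (∀ i j → i ≢ j → ¬ f i j ≈ 0#) → ¬ Π<[ n ] f ≈ 0#
  Π<-nonzero n f f≉0 = Π-nonzero n (λ i → Π-nonzero n (λ j → if-nonzero i j (i <? j)))
    where
    if-nonzero : ∀ i j (i<?j : Dec (i Fin.< j)) → ¬ (if does i<?j then f i j else 1#) ≈ 0#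
    if-nonzero i j (yes i<j) = f≉0 i j (Fin.<⇒≢ i<j)
    if-nonzero i j (no _)    = 1≉0

  -- Determinants

  Matrix : ℕ → Set c
  Matrix n = Fin n → Fin n → Carrier

  _ᵀ : ∀ {n} → Matrix n → Matrix n
  (A ᵀ) i j = A j i

  minor : ∀ {n} → Matrix (suc n) → Fin (suc n) → Fin (suc n) → Matrix n
  minor A i j r k = A (punchIn i r) (punchIn j k)

  sgn : ∀ {n} → Fin n → Carrier
  sgn j = (- 1#) ^ℕ toℕ j

  laplaceTerm : ∀ {n} → Matrix (suc n) → Fin (suc n) → Carrier
  laplaceTerm {n} A j = (sgn j * A zero j) * det n (minor A zero j)

  det-cong : ∀ n {A B : Matrix n} → (∀ i j → A i j ≈ B i j) → det n A ≈ det n B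
  det-cong zero            A≈B = refl
  det-cong (suc n) {A} {B} A≈B = Σ-cong (suc n) {laplaceTerm A} {laplaceTerm B} (λ j →
    *-cong (*-congˡ (A≈B zero j)) (det-cong n (λ r k → A≈B (suc r) (punchIn j k))))

  det-scaleRows : ∀ n (d : Fin n → Carrier) (A : Matrix n) →
                  det n (λ i j → d i * A i j) ≈ Π[ n ] d * det n A
  det-scaleRows zero    d A = sym (*-identityʳ _)
  det-scaleRows (suc n) d A =
    trans (Σ-cong (suc n) scaleTerm) (sym (*-distribˡ-Σ (suc n) (Π[ suc n ] d) (laplaceTerm A)))
    where
    regroup : ∀ s x y p D → (s * (x * y)) * (p * D) ≈ (x * p) * ((s * y) * D)
    regroup = solve 5 (λ s x y p D → (s :* (x :* y)) :* (p :* D) := (x :* p) :* ((s :* y) :* D)) refl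
    scaleTerm : ∀ j → laplaceTerm (λ i j → d i * A i j) j ≈ Π[ suc n ] d * laplaceTerm A j
    scaleTerm j = trans (*-congˡ (det-scaleRows n (d ∘ suc) (minor A zero j))) (regroup _ _ _ _ _)

  columnTerm : ∀ {n} → Matrix (suc n) → Fin (suc n) → Carrier
  columnTerm {n} A i = (sgn i * A i zero) * det n (minor A i zero)

  det-expandFirstColumn : ∀ n (A : Matrix (suc n)) → det (suc n) A ≈ Σ[ suc n ] (columnTerm A)
  det-expandFirstColumn zero    A = refl
  det-expandFirstColumn (suc m) A = +-congˡ (begin
    Σ[ suc m ] (λ j → laplaceTerm A (suc j))
      ≈⟨ Σ-cong (suc m) expandMinor ⟩
    Σ[ suc m ] (λ j → Σ[ suc m ] (λ i → a j * (b i * X i j)))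
      ≈⟨ Σ-comm (suc m) (suc m) (λ j i → a j * (b i * X i j)) ⟩
    Σ[ suc m ] (λ i → Σ[ suc m ] (λ j → a j * (b i * X i j)))
      ≈⟨ Σ-cong (suc m) collapseRow ⟨
    Σ[ suc m ] (λ i → columnTerm A (suc i)) ∎)
    where
    X : Fin (suc m) → Fin (suc m) → Carrier
    X i j = det m (λ r k → A (suc (punchIn i r)) (suc (punchIn j k)))
    a b : Fin (suc m) → Carrier
    a j = sgn (suc j) * A zero (suc j)
    b i = sgn i * A (suc i) zero
    swapSigns : ∀ sj x si y D → ((- 1# * sj) * x) * ((si * y) * D) ≈ ((- 1# * si) * y) * ((sj * x) * D)
    swapSigns = solve 5 (λ sj x si y D →
      ((:- con (+ 1) :* sj) :* x) :* ((si :* y) :* D) := ((:- con (+ 1) :* si) :* y) :* ((sj :* x) :* D)) refl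
    expandMinor : ∀ j → laplaceTerm A (suc j) ≈ Σ[ suc m ] (λ i → a j * (b i * X i j))
    expandMinor j = trans (*-congˡ (det-expandFirstColumn m (minor A zero (suc j))))
                          (*-distribˡ-Σ (suc m) (a j) (λ i → b i * X i j))
    collapseRow : ∀ i → columnTerm A (suc i) ≈ Σ[ suc m ] (λ j → a j * (b i * X i j))
    collapseRow i =
      trans (*-distribˡ-Σ (suc m) (sgn (suc i) * A (suc i) zero) (λ j → (sgn j * A zero (suc j)) * X i j))
            (Σ-cong (suc m) (λ j → sym (swapSigns (sgn j) (A zero (suc j)) (sgn i) (A (suc i) zero) (X i j))))

  det-ᵀ : ∀ n (A : Matrix n) → det n (A ᵀ) ≈ det n A
  det-ᵀ zero    A = refl
  det-ᵀ (suc n) A = trans (Σ-cong (suc n) {laplaceTerm (A ᵀ)} {columnTerm A} (λ i →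
                      *-congˡ (det-ᵀ n (minor A i zero)))) (sym (det-expandFirstColumn n A))

  det-scaleCols : ∀ n (d : Fin n → Carrier) (A : Matrix n) →
                  det n (λ i j → A i j * d j) ≈ Π[ n ] d * det n A
  det-scaleCols n d A = begin
    det n (λ i j → A i j * d j)   ≈⟨ det-ᵀ n _ ⟨
    det n (λ i j → A j i * d i)   ≈⟨ det-cong n (λ i j → *-comm _ _) ⟩
    det n (λ i j → d i * A j i)   ≈⟨ det-scaleRows n d (A ᵀ) ⟩
    Π[ n ] d * det n (A ᵀ)        ≈⟨ *-congˡ (det-ᵀ n A) ⟩
    Π[ n ] d * det n A            ∎

  det-lowerTriangular : ∀ n (A : Matrix n) → (∀ i j → i Fin.< j → A i j ≈ 0#) →
                        det n A ≈ Π[ n ] (λ i → A i i)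
  det-lowerTriangular zero    A upper≈0 = refl
  det-lowerTriangular (suc n) A upper≈0 = trans (+-cong diagonalTerm offDiagonal) (+-identityʳ _)
    where
    diagonalTerm : laplaceTerm A zero ≈ A zero zero * Π[ n ] (λ i → A (suc i) (suc i))
    diagonalTerm = *-cong (*-identityˡ _)
      (det-lowerTriangular n (minor A zero zero) (λ i j i<j → upper≈0 (suc i) (suc j) (ℕ.s≤s i<j)))
    offDiagonal : Σ[ n ] (λ j → laplaceTerm A (suc j)) ≈ 0#
    offDiagonal = Σ-zero n (λ j →
      trans (*-congʳ (trans (*-congˡ (upper≈0 zero (suc j) (ℕ.s≤s ℕ.z≤n))) (zeroʳ _))) (zeroˡ _))

  det-upperTriangular : ∀ n (A : Matrix n) → (∀ i j → j Fin.< i → A i j ≈ 0#) →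
                        det n A ≈ Π[ n ] (λ i → A i i)
  det-upperTriangular n A lower≈0 =
    trans (sym (det-ᵀ n A)) (det-lowerTriangular n (A ᵀ) (λ i j j<i → lower≈0 j i j<i))

  det-firstColumnSparse : ∀ n (A : Matrix (suc n)) → (∀ i → A (suc i) zero ≈ 0#) →
                          det (suc n) A ≈ A zero zero * det n (minor A zero zero)
  det-firstColumnSparse n A column≈0 =
    trans (det-expandFirstColumn n A) (trans (+-cong (*-congʳ (*-identityˡ _)) lowerTerms) (+-identityʳ _))
    where
    lowerTerms : Σ[ n ] (λ i → columnTerm A (suc i)) ≈ 0#
    lowerTerms = Σ-zero n (λ i → trans (*-congʳ (trans (*-congˡ (column≈0 i)) (zeroʳ _))) (zeroˡ _))

  -- swapAt c exchanges the positions inject₁ c and suc c.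
  swapAt : ∀ {n} → Fin (suc n) → Fin (suc (suc n)) → Fin (suc (suc n))
  swapAt         zero    zero          = suc zero
  swapAt         zero    (suc zero)    = zero
  swapAt         zero    (suc (suc i)) = suc (suc i)
  swapAt {suc n} (suc c) zero          = zero
  swapAt {suc n} (suc c) (suc i)       = suc (swapAt c i)

  det-swapFirstColumns : ∀ n (A : Matrix (suc (suc n))) →
                         det (suc (suc n)) (λ i j → A i (swapAt zero j)) ≈ - det (suc (suc n)) A
  det-swapFirstColumns n A = begin
    laplaceTerm A′ zero + (laplaceTerm A′ (suc zero) + Σ[ n ] (λ j → laplaceTerm A′ (suc (suc j))))
      ≈⟨ +-cong (*-congˡ (det-cong (suc n) minor₀≈minor₁))
                (+-cong (*-congˡ (det-cong (suc n) minor₁≈minor₀)) (laterTerms n A)) ⟩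
    (1# * A zero (suc zero)) * D₁ + ((- 1# * 1#) * A zero zero * D₀ + - rest)
      ≈⟨ swapFirstTerms (A zero zero) (A zero (suc zero)) D₀ D₁ rest ⟩
    - det (suc (suc n)) A ∎
    where
    A′ : Matrix (suc (suc n))
    A′ i j = A i (swapAt zero j)
    D₀ D₁ rest : Carrier
    D₀ = det (suc n) (minor A zero zero)
    D₁ = det (suc n) (minor A zero (suc zero))
    rest = Σ[ n ] (λ j → laplaceTerm A (suc (suc j)))
    minor₀≈minor₁ : ∀ i k → minor A′ zero zero i k ≈ minor A zero (suc zero) i k
    minor₀≈minor₁ i zero    = refl
    minor₀≈minor₁ i (suc k) = refl
    minor₁≈minor₀ : ∀ i k → minor A′ zero (suc zero) i k ≈ minor A zero zero i k
    minor₁≈minor₀ i zero    = refl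
    minor₁≈minor₀ i (suc k) = refl
    swapFirstTerms : ∀ x y D₀ D₁ S →
      (1# * y) * D₁ + ((- 1# * 1#) * x * D₀ + - S) ≈ - ((1# * x) * D₀ + ((- 1# * 1#) * y * D₁ + S))
    swapFirstTerms = solve 5 (λ x y D₀ D₁ S →
      (con (+ 1) :* y) :* D₁ :+ ((:- con (+ 1) :* con (+ 1)) :* x :* D₀ :+ :- S)
      := :- ((con (+ 1) :* x) :* D₀ :+ ((:- con (+ 1) :* con (+ 1)) :* y :* D₁ :+ S))) refl
    laterTerms : ∀ n (A : Matrix (suc (suc n))) →
      Σ[ n ] (λ j → laplaceTerm (λ i k → A i (swapAt zero k)) (suc (suc j)))
      ≈ - Σ[ n ] (λ j → laplaceTerm A (suc (suc j)))
    laterTerms zero    A = sym -0#≈0#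
    laterTerms (suc n) A =
      trans (Σ-cong (suc n) negateTerm) (sym (-‿distrib-Σ (suc n) (λ j → laplaceTerm A (suc (suc j)))))
      where
      minorSwapped : ∀ j i k → minor (λ i k → A i (swapAt zero k)) zero (suc (suc j)) i k
                               ≈ minor A zero (suc (suc j)) i (swapAt zero k)
      minorSwapped j i zero          = refl
      minorSwapped j i (suc zero)    = refl
      minorSwapped j i (suc (suc k)) = refl
      negateTerm : ∀ j → laplaceTerm (λ i k → A i (swapAt zero k)) (suc (suc j))
                         ≈ - laplaceTerm A (suc (suc j))
      negateTerm j = trans (*-congˡ (trans (det-cong (suc (suc n)) (minorSwapped j))
                                           (det-swapFirstColumns n (minor A zero (suc (suc j))))))
                           (sym (-‿distribʳ-* _ _))

  det-equalFirstColumns : ∀ n (A : Matrix (suc (suc n))) → (∀ i → A i zero ≈ A i (suc zero)) →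
                          det (suc (suc n)) A ≈ 0#
  det-equalFirstColumns n A col₀≈col₁ =
    trans (sym (+-assoc _ _ _))
          (trans (+-cong firstTermsCancel (laterTerms n A col₀≈col₁)) (+-identityʳ _))
    where
    firstTermsCancel : laplaceTerm A zero + laplaceTerm A (suc zero) ≈ 0#
    firstTermsCancel = begin
      (1# * A zero zero) * det (suc n) (minor A zero zero)
        + ((- 1#) * 1#) * A zero (suc zero) * det (suc n) (minor A zero (suc zero))
        ≈⟨ +-congˡ (*-cong (*-congˡ (sym (col₀≈col₁ zero))) (det-cong (suc n) minor₁≈minor₀)) ⟩
      (1# * A zero zero) * det (suc n) (minor A zero zero)
        + ((- 1#) * 1#) * A zero zero * det (suc n) (minor A zero zero)
        ≈⟨ cancel (A zero zero) (det (suc n) (minor A zero zero)) ⟩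
      0# ∎
      where
      minor₁≈minor₀ : ∀ i k → minor A zero (suc zero) i k ≈ minor A zero zero i k
      minor₁≈minor₀ i zero    = col₀≈col₁ (suc i)
      minor₁≈minor₀ i (suc k) = refl
      cancel : ∀ x D → (1# * x) * D + ((- 1#) * 1#) * x * D ≈ 0#
      cancel = solve 2 (λ x D → (con (+ 1) :* x) :* D :+ ((:- con (+ 1)) :* con (+ 1)) :* x :* D := con (+ 0)) refl
    laterTerms : ∀ n (A : Matrix (suc (suc n))) → (∀ i → A i zero ≈ A i (suc zero)) →
                 Σ[ n ] (λ j → laplaceTerm A (suc (suc j))) ≈ 0#
    laterTerms zero    A col₀≈col₁ = refl
    laterTerms (suc n) A col₀≈col₁ = Σ-zero (suc n) {λ j → laplaceTerm A (suc (suc j))} (λ j → trans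
      (*-congˡ (det-equalFirstColumns n (minor A zero (suc (suc j))) (col₀≈col₁ ∘ suc))) (zeroʳ _))

  det-swapAdjacentRows : ∀ n (c : Fin (suc n)) (A : Matrix (suc (suc n))) →
                         det (suc (suc n)) (λ i j → A (swapAt c i) j) ≈ - det (suc (suc n)) A
  det-swapAdjacentRows n zero A = begin
    det (suc (suc n)) (λ i j → A (swapAt zero i) j)   ≈⟨ det-ᵀ (suc (suc n)) (λ i j → A (swapAt zero j) i) ⟩
    det (suc (suc n)) (λ i j → A (swapAt zero j) i)   ≈⟨ det-swapFirstColumns n (A ᵀ) ⟩
    - det (suc (suc n)) (A ᵀ)                         ≈⟨ -‿cong (det-ᵀ (suc (suc n)) A) ⟩
    - det (suc (suc n)) A                             ∎
  det-swapAdjacentRows (suc n) (suc c) A =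
    trans (Σ-cong (suc (suc (suc n))) {laplaceTerm (λ i j → A (swapAt (suc c) i) j)} negateTerm)
          (sym (-‿distrib-Σ (suc (suc (suc n))) (laplaceTerm A)))
    where
    negateTerm : ∀ j → laplaceTerm (λ i j → A (swapAt (suc c) i) j) j ≈ - laplaceTerm A j
    negateTerm j = trans (*-congˡ (det-swapAdjacentRows n c (minor A zero j))) (sym (-‿distribʳ-* _ _))

  sgn-nonzero : ∀ {n} (k : Fin n) → ¬ sgn k ≈ 0#
  sgn-nonzero k = ^ℕ-nonzero (toℕ k) (-‿nonzero 1≉0)

  moveToTop : ∀ {n} → Fin (suc n) → Fin (suc n) → Fin (suc n)
  moveToTop k zero    = k
  moveToTop k (suc i) = punchIn k i

  swapAt∘moveToTop : ∀ {n} (c : Fin (suc n)) r → swapAt c (moveToTop (inject₁ c) r) ≡ moveToTop (suc c) r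
  swapAt∘moveToTop         zero    zero          = ≡.refl
  swapAt∘moveToTop         zero    (suc zero)    = ≡.refl
  swapAt∘moveToTop         zero    (suc (suc i)) = ≡.refl
  swapAt∘moveToTop {suc n} (suc c) zero          = ≡.cong suc (swapAt∘moveToTop c zero)
  swapAt∘moveToTop {suc n} (suc c) (suc zero)    = ≡.refl
  swapAt∘moveToTop {suc n} (suc c) (suc (suc i)) = ≡.cong suc (swapAt∘moveToTop c (suc i))

  det-moveToTop : ∀ n (k : Fin (suc n)) (A : Matrix (suc n)) →
                  det (suc n) (λ i j → A (moveToTop k i) j) ≈ sgn k * det (suc n) A
  det-moveToTop n k = byDistance (toℕ k) n k ≡.refl
    where
    byDistance : ∀ m n (k : Fin (suc n)) → toℕ k ≡ m → (A : Matrix (suc n)) →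
                 det (suc n) (λ i j → A (moveToTop k i) j) ≈ sgn k * det (suc n) A
    byDistance m n zero _ A = trans (det-cong (suc n) unchanged) (sym (*-identityˡ _))
      where
      unchanged : ∀ i j → A (moveToTop zero i) j ≈ A i j
      unchanged zero    j = refl
      unchanged (suc i) j = refl
    byDistance (suc m) (suc n) (suc k) k≡m A = begin
      det (suc (suc n)) (λ i j → A (moveToTop (suc k) i) j)
        ≈⟨ det-cong (suc (suc n)) (λ i j → reflexive (≡.cong (λ r → A r j) (swapAt∘moveToTop k i))) ⟨
      det (suc (suc n)) (λ i j → A (swapAt k (moveToTop (inject₁ k) i)) j)
        ≈⟨ byDistance m (suc n) (inject₁ k) (≡.trans (Fin.toℕ-inject₁ k) (ℕ.suc-injective k≡m))
                      (λ i j → A (swapAt k i) j) ⟩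
      sgn (inject₁ k) * det (suc (suc n)) (λ i j → A (swapAt k i) j)
        ≈⟨ *-cong (reflexive (≡.cong ((- 1#) ^ℕ_) (Fin.toℕ-inject₁ k))) (det-swapAdjacentRows n k A) ⟩
      sgn k * - det (suc (suc n)) A
        ≈⟨ flipSign (sgn k) _ ⟩
      sgn (suc k) * det (suc (suc n)) A ∎
      where
      flipSign : ∀ s d → s * (- d) ≈ (- 1# * s) * d
      flipSign = solve 2 (λ s d → s :* (:- d) := (:- con (+ 1) :* s) :* d) refl


  det-equalFirstRows : ∀ n (A : Matrix (suc (suc n))) → (∀ j → A zero j ≈ A (suc zero) j) →
                       det (suc (suc n)) A ≈ 0#
  det-equalFirstRows n A row₀≈row₁ =
    trans (sym (det-ᵀ (suc (suc n)) A)) (det-equalFirstColumns n (A ᵀ) row₀≈row₁)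

  det-equalRowMovedToTop : ∀ n (A : Matrix (suc (suc n))) (k : Fin (suc (suc n))) →
    (∀ j → A k j ≈ A (moveToTop k (suc zero)) j) → det (suc (suc n)) A ≈ 0#
  det-equalRowMovedToTop n A k rowₖ≈row = *-cancelˡ (sgn-nonzero k) (begin
    sgn k * det (suc (suc n)) A   ≈⟨ det-moveToTop (suc n) k A ⟨
    det (suc (suc n)) Aₖ          ≈⟨ det-equalFirstRows n Aₖ rowₖ≈row ⟩
    0#                            ≈⟨ zeroʳ _ ⟨
    sgn k * 0#                    ∎)
    where
    Aₖ : Matrix (suc (suc n))
    Aₖ i j = A (moveToTop k i) j

  det-equalRows : ∀ n (A : Matrix n) (a b : Fin n) → a ≢ b → (∀ j → A a j ≈ A b j) → det n A ≈ 0#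
  det-equalRows (suc n)       A zero    zero    a≢b rowa≈rowb = ⊥-elim (a≢b ≡.refl)
  det-equalRows (suc (suc n)) A zero    (suc b) a≢b rowa≈rowb =
    det-equalRowMovedToTop n A (suc b) (sym ∘ rowa≈rowb)
  det-equalRows (suc (suc n)) A (suc a) zero    a≢b rowa≈rowb =
    det-equalRowMovedToTop n A (suc a) rowa≈rowb
  det-equalRows (suc n)       A (suc a) (suc b) a≢b rowa≈rowb =
    Σ-zero (suc n) {laplaceTerm A} (λ j → trans (*-congˡ (det-equalRows n (minor A zero j) a b
      (a≢b ∘ ≡.cong suc) (rowa≈rowb ∘ punchIn j))) (zeroʳ _))

  Σ-maps : ∀ n m → ((Fin n → Fin m) → Carrier) → Carrier
  Σ-maps zero    m h = h []
  Σ-maps (suc n) m h = Σ[ m ] λ k → Σ-maps n m (λ g → h (k ∷ g))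

  Σ-maps-cong : ∀ n m {h h′ : (Fin n → Fin m) → Carrier} → (∀ g → h g ≈ h′ g) →
                Σ-maps n m h ≈ Σ-maps n m h′
  Σ-maps-cong zero    m h≈h′ = h≈h′ []
  Σ-maps-cong (suc n) m h≈h′ = Σ-cong m (λ k → Σ-maps-cong n m (λ g → h≈h′ (k ∷ g)))

  *-distribˡ-Σ-maps : ∀ n m a (h : (Fin n → Fin m) → Carrier) →
                      a * Σ-maps n m h ≈ Σ-maps n m (λ g → a * h g)
  *-distribˡ-Σ-maps zero    m a h = refl
  *-distribˡ-Σ-maps (suc n) m a h = trans (*-distribˡ-Σ m a (λ k → Σ-maps n m (λ g → h (k ∷ g))))
    (Σ-cong m (λ k → *-distribˡ-Σ-maps n m a (λ g → h (k ∷ g))))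

  *-distribʳ-Σ-maps : ∀ n m a (h : (Fin n → Fin m) → Carrier) →
                      Σ-maps n m h * a ≈ Σ-maps n m (λ g → h g * a)
  *-distribʳ-Σ-maps n m a h =
    trans (*-comm _ _) (trans (*-distribˡ-Σ-maps n m a h) (Σ-maps-cong n m (λ g → *-comm _ _)))

  Σ-maps-comm-Σ : ∀ n m p (f : (Fin n → Fin m) → Fin p → Carrier) →
                  Σ-maps n m (λ g → Σ[ p ] (f g)) ≈ Σ[ p ] (λ j → Σ-maps n m (λ g → f g j))
  Σ-maps-comm-Σ zero    m p f = refl
  Σ-maps-comm-Σ (suc n) m p f =
    trans (Σ-cong m (λ k → Σ-maps-comm-Σ n m p (λ g → f (k ∷ g))))
          (Σ-comm m p (λ k j → Σ-maps n m (λ g → f (k ∷ g) j)))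

  det-expandProductRows : ∀ n m (A : Fin n → Fin m → Carrier) (B : Fin m → Fin n → Carrier) →
    det n (λ r j → Σ[ m ] (λ k → A r k * B k j))
    ≈ Σ-maps n m (λ g → Π[ n ] (λ r → A r (g r)) * det n (λ r j → B (g r) j))
  det-expandProductRows zero    m A B = sym (*-identityˡ _)
  det-expandProductRows (suc n) m A B = begin
    Σ[ suc n ] (λ j → (sgn j * Σ[ m ] (λ k → A zero k * B k j)) * det n (λ r j′ → AB′ j r j′))
      ≈⟨ Σ-cong (suc n) expandTerm ⟩
    Σ[ suc n ] (λ j → Σ[ m ] (λ k → Σ-maps n m (λ g → X j k g)))
      ≈⟨ Σ-comm (suc n) m (λ j k → Σ-maps n m (λ g → X j k g)) ⟩
    Σ[ m ] (λ k → Σ[ suc n ] (λ j → Σ-maps n m (λ g → X j k g)))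
      ≈⟨ Σ-cong m (λ k → trans (sym (Σ-maps-comm-Σ n m (suc n) (λ g j → X j k g)))
                               (Σ-maps-cong n m (collectRow k))) ⟩
    Σ[ m ] (λ k → Σ-maps n m (λ g →
      Π[ suc n ] (λ r → A r ((k ∷ g) r)) * det (suc n) (λ r j → B ((k ∷ g) r) j))) ∎
    where
    AB′ : Fin (suc n) → Fin n → Fin n → Carrier
    AB′ j r j′ = Σ[ m ] (λ k → A (suc r) k * B k (punchIn j j′))
    P : (Fin n → Fin m) → Carrier
    P g = Π[ n ] (λ r → A (suc r) (g r))
    D : Fin (suc n) → (Fin n → Fin m) → Carrier
    D j g = det n (λ r j′ → B (g r) (punchIn j j′))
    X : Fin (suc n) → Fin m → (Fin n → Fin m) → Carrier
    X j k g = (sgn j * (A zero k * B k j)) * (P g * D j g)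
    expandTerm : ∀ j → (sgn j * Σ[ m ] (λ k → A zero k * B k j)) * det n (AB′ j)
                       ≈ Σ[ m ] (λ k → Σ-maps n m (λ g → X j k g))
    expandTerm j = begin
      (sgn j * Σ[ m ] (λ k → A zero k * B k j)) * det n (AB′ j)
        ≈⟨ *-cong (*-distribˡ-Σ m (sgn j) _)
                  (det-expandProductRows n m (A ∘ suc) (λ k j′ → B k (punchIn j j′))) ⟩
      Σ[ m ] (λ k → sgn j * (A zero k * B k j)) * Σ-maps n m (λ g → P g * D j g)
        ≈⟨ *-distribʳ-Σ m _ _ ⟩
      Σ[ m ] (λ k → (sgn j * (A zero k * B k j)) * Σ-maps n m (λ g → P g * D j g))
        ≈⟨ Σ-cong m (λ k → *-distribˡ-Σ-maps n m _ _) ⟩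
      Σ[ m ] (λ k → Σ-maps n m (λ g → X j k g)) ∎
    regroup : ∀ s a b p d → (s * (a * b)) * (p * d) ≈ (a * p) * ((s * b) * d)
    regroup = solve 5 (λ s a b p d → (s :* (a :* b)) :* (p :* d) := (a :* p) :* ((s :* b) :* d)) refl
    collectRow : ∀ k g → Σ[ suc n ] (λ j → X j k g)
                         ≈ Π[ suc n ] (λ r → A r ((k ∷ g) r)) * det (suc n) (λ r j → B ((k ∷ g) r) j)
    collectRow k g = trans (Σ-cong (suc n) (λ j → regroup (sgn j) (A zero k) (B k j) (P g) (D j g)))
                           (sym (*-distribˡ-Σ (suc n) (A zero k * P g) (λ j → (sgn j * B k j) * D j g)))

  1ᴹ : ∀ {n} → Matrix n
  1ᴹ zero    zero    = 1#
  1ᴹ zero    (suc j) = 0#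
  1ᴹ (suc i) zero    = 0#
  1ᴹ (suc i) (suc j) = 1ᴹ i j

  Σ-*-1ᴹ : ∀ n (f : Fin n → Carrier) j → Σ[ n ] (λ k → f k * 1ᴹ k j) ≈ f j
  Σ-*-1ᴹ (suc n) f zero    = trans (+-cong (*-identityʳ _) (Σ-zero n (λ k → zeroʳ (f (suc k))))) (+-identityʳ _)
  Σ-*-1ᴹ (suc n) f (suc j) = trans (+-cong (zeroʳ _) (Σ-*-1ᴹ n (f ∘ suc) j)) (+-identityˡ _)

  det-1ᴹ : ∀ n → det n 1ᴹ ≈ 1#
  det-1ᴹ n = trans (det-lowerTriangular n 1ᴹ upper≈0) (Π-one n diagonal≈1)
    where
    upper≈0 : ∀ {n} (i j : Fin n) → i Fin.< j → 1ᴹ i j ≈ 0#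
    upper≈0 zero    (suc j) i<j         = refl
    upper≈0 (suc i) (suc j) (ℕ.s≤s i<j) = upper≈0 i j i<j
    diagonal≈1 : ∀ {n} (i : Fin n) → 1ᴹ i i ≈ 1#
    diagonal≈1 zero    = refl
    diagonal≈1 (suc i) = diagonal≈1 i

  reindexSign : ∀ n → (Fin n → Fin n) → Carrier
  reindexSign n g = det n (λ r j → 1ᴹ (g r) j)

  det-reindexRows-collision : ∀ n (g : Fin n → Fin n) (B : Matrix n) {i j} → i ≢ j → g i ≡ g j →
                              det n (λ r k → B (g r) k) ≈ reindexSign n g * det n B
  det-reindexRows-collision n g B i≢j gi≡gj = begin
    det n (λ r k → B (g r) k)
      ≈⟨ det-equalRows n _ _ _ i≢j (λ k → reflexive (≡.cong (λ x → B x k) gi≡gj)) ⟩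
    0#
      ≈⟨ zeroˡ _ ⟨
    0# * det n B
      ≈⟨ *-congʳ (det-equalRows n _ _ _ i≢j (λ k → reflexive (≡.cong (λ x → 1ᴹ x k) gi≡gj))) ⟨
    reindexSign n g * det n B ∎

  det-reindexRows-fixingZero : ∀ n → (∀ g B → det n (λ r k → B (g r) k) ≈ reindexSign n g * det n B) →
    ∀ (h : Fin (suc n) → Fin (suc n)) → h zero ≡ zero → (B : Matrix (suc n)) →
    det (suc n) (λ r k → B (h r) k) ≈ reindexSign (suc n) h * det (suc n) B
  det-reindexRows-fixingZero n ih h h0≡0 B with Fin.any? (λ i → h (suc i) Fin.≟ zero)
  ... | yes (i , hi≡0) = det-reindexRows-collision (suc n) h B {zero} {suc i} (λ ()) (≡.trans h0≡0 (≡.sym hi≡0))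
  ... | no  h≢0 =
    trans (expand B) (*-congʳ (sym (trans (expand 1ᴹ) (trans (*-congˡ (det-1ᴹ (suc n))) (*-identityʳ _)))))
    where
    h′ : Fin n → Fin n
    h′ i = Fin.punchOut {i = zero} (λ 0≡hi → h≢0 (i , ≡.sym 0≡hi))
    h∘suc≡suc∘h′ : ∀ i → h (suc i) ≡ suc (h′ i)
    h∘suc≡suc∘h′ i = ≡.sym (Fin.punchIn-punchOut {i = zero} (λ 0≡hi → h≢0 (i , ≡.sym 0≡hi)))
    expand : (B : Matrix (suc n)) → det (suc n) (λ r k → B (h r) k) ≈ reindexSign n h′ * det (suc n) B
    expand B = trans (Σ-cong (suc n) {laplaceTerm (λ r k → B (h r) k)} expandTerm)
                     (sym (*-distribˡ-Σ (suc n) (reindexSign n h′) (laplaceTerm B)))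
      where
      expandTerm : ∀ j → laplaceTerm (λ r k → B (h r) k) j ≈ reindexSign n h′ * laplaceTerm B j
      expandTerm j = begin
        (sgn j * B (h zero) j) * det n (λ r k → B (h (suc r)) (punchIn j k))
          ≈⟨ *-cong (*-congˡ (reflexive (≡.cong (λ x → B x j) h0≡0)))
                    (det-cong n (λ r k → reflexive (≡.cong (λ x → B x (punchIn j k)) (h∘suc≡suc∘h′ r)))) ⟩
        (sgn j * B zero j) * det n (λ r k → minor B zero j (h′ r) k)
          ≈⟨ *-congˡ (ih h′ (minor B zero j)) ⟩
        (sgn j * B zero j) * (reindexSign n h′ * det n (minor B zero j))
          ≈⟨ x∙yz≈y∙xz _ _ _ ⟩
        reindexSign n h′ * laplaceTerm B j ∎

  -- If g is not injective, two rows coincide; otherwise moving the row sent to zero to the top makes g fix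
  -- zero, and expanding along that row reduces to size n.
  det-reindexRows : ∀ n (g : Fin n → Fin n) (B : Matrix n) →
                    det n (λ r k → B (g r) k) ≈ reindexSign n g * det n B
  det-reindexRows zero    g B = sym (*-identityˡ _)
  det-reindexRows (suc n) g B with Fin.any? (λ k → g k Fin.≟ zero)
  ... | yes (k , gk≡0) = *-cancelˡ (sgn-nonzero k) (begin
    sgn k * det (suc n) (λ r j → B (g r) j)
      ≈⟨ det-moveToTop n k (λ r j → B (g r) j) ⟨
    det (suc n) (λ r j → B (g′ r) j)
      ≈⟨ det-reindexRows-fixingZero n (det-reindexRows n) g′ gk≡0 B ⟩
    reindexSign (suc n) g′ * det (suc n) B
      ≈⟨ *-congʳ (det-moveToTop n k (λ r j → 1ᴹ (g r) j)) ⟩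
    (sgn k * reindexSign (suc n) g) * det (suc n) B
      ≈⟨ *-assoc _ _ _ ⟩
    sgn k * (reindexSign (suc n) g * det (suc n) B) ∎)
    where
    g′ : Fin (suc n) → Fin (suc n)
    g′ = g ∘ moveToTop k
  ... | no  g≢0 = det-reindexRows-collision (suc n) g B (Fin.<⇒≢ i<j) gi≡gj
    where
    g₋ : Fin (suc n) → Fin n
    g₋ r = Fin.punchOut {i = zero} (λ 0≡gr → g≢0 (r , ≡.sym 0≡gr))
    collision = Fin.pigeonhole (ℕ.n<1+n n) g₋
    i j : Fin (suc n)
    i = proj₁ collision
    j = proj₁ (proj₂ collision)
    i<j = proj₁ (proj₂ (proj₂ collision))
    gi≡gj : g i ≡ g j
    gi≡gj = Fin.punchOut-injective (λ 0≡gi → g≢0 (i , ≡.sym 0≡gi)) (λ 0≡gj → g≢0 (j , ≡.sym 0≡gj))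
                                   (proj₂ (proj₂ (proj₂ collision)))

  det-* : ∀ n (A B : Matrix n) → det n (λ r j → Σ[ n ] (λ k → A r k * B k j)) ≈ det n A * det n B
  det-* n A B = begin
    det n (λ r j → Σ[ n ] (λ k → A r k * B k j))
      ≈⟨ det-expandProductRows n n A B ⟩
    Σ-maps n n (λ g → Π[ n ] (λ r → A r (g r)) * det n (λ r j → B (g r) j))
      ≈⟨ Σ-maps-cong n n (λ g → trans (*-congˡ (det-reindexRows n g B)) (sym (*-assoc _ _ _))) ⟩
    Σ-maps n n (λ g → (Π[ n ] (λ r → A r (g r)) * reindexSign n g) * det n B)
      ≈⟨ *-distribʳ-Σ-maps n n (det n B) _ ⟨
    Σ-maps n n (λ g → Π[ n ] (λ r → A r (g r)) * reindexSign n g) * det n B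
      ≈⟨ *-congʳ (det-expandProductRows n n A 1ᴹ) ⟨
    det n (λ r j → Σ[ n ] (λ k → A r k * 1ᴹ k j)) * det n B
      ≈⟨ *-congʳ (det-cong n (λ r j → Σ-*-1ᴹ n (A r) j)) ⟩
    det n A * det n B ∎

  -- The Vandermonde determinant

  vandermonde : ∀ n → (Fin n → Carrier) → Matrix n
  vandermonde n x r j = x j ^ℕ (n ∸ suc (toℕ r))

  -- Left multiplication by rowReduction a subtracts a times row r + 1 from each row r.
  rowReduction : ∀ {n} → Carrier → Matrix n
  rowReduction {suc n}       a zero    zero          = 1#
  rowReduction {suc (suc n)} a zero    (suc zero)    = - a
  rowReduction {suc (suc n)} a zero    (suc (suc k)) = 0#
  rowReduction {suc n}       a (suc r) zero          = 0#
  rowReduction {suc n}       a (suc r) (suc k)       = rowReduction a r k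

  det-rowReduction : ∀ n a → det n (rowReduction a) ≈ 1#
  det-rowReduction n a = trans (det-upperTriangular n (rowReduction a) lower≈0) (Π-one n diagonal≈1)
    where
    lower≈0 : ∀ {n} (i j : Fin n) → j Fin.< i → rowReduction a i j ≈ 0#
    lower≈0 {suc n} (suc i) zero    j<i         = refl
    lower≈0 {suc n} (suc i) (suc j) (ℕ.s≤s j<i) = lower≈0 i j j<i
    diagonal≈1 : ∀ {n} (i : Fin n) → rowReduction a i i ≈ 1#
    diagonal≈1 {suc n} zero    = refl
    diagonal≈1 {suc n} (suc i) = diagonal≈1 i

  reducedRow : Carrier → ∀ m → Fin (suc m) → Carrier → Carrier
  reducedRow a zero    zero    y = 1#
  reducedRow a (suc m) zero    y = y ^ℕ m * (y - a)
  reducedRow a (suc m) (suc r) y = reducedRow a m r y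

  rowReduction-vandermonde : ∀ a m (r : Fin (suc m)) y →
    Σ[ suc m ] (λ k → rowReduction a r k * y ^ℕ (m ∸ toℕ k)) ≈ reducedRow a m r y
  rowReduction-vandermonde a zero    zero    y = trans (+-identityʳ _) (*-identityˡ _)
  rowReduction-vandermonde a (suc m) zero    y =
    trans (+-congˡ (+-congˡ (Σ-zero m (λ k → zeroˡ (y ^ℕ (m ∸ suc (toℕ k)))))))
          (factor a y (y ^ℕ m))
    where
    factor : ∀ a y p → 1# * (y * p) + (- a * p + 0#) ≈ p * (y - a)
    factor = solve 3 (λ a y p → con (+ 1) :* (y :* p) :+ ((:- a) :* p :+ con (+ 0)) := p :* (y :- a)) refl
  rowReduction-vandermonde a (suc m) (suc r) y =
    trans (+-cong (zeroˡ _) (rowReduction-vandermonde a m r y)) (+-identityˡ _)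

  reducedRow-last : ∀ a m y → reducedRow a m (fromℕ m) y ≡ 1#
  reducedRow-last a zero    y = ≡.refl
  reducedRow-last a (suc m) y = reducedRow-last a m y

  reducedRow-punchIn : ∀ a m (i : Fin m) y →
                       reducedRow a m (punchIn (fromℕ m) i) y ≡ y ^ℕ (m ∸ suc (toℕ i)) * (y - a)
  reducedRow-punchIn a (suc m) zero    y = ≡.refl
  reducedRow-punchIn a (suc m) (suc i) y = reducedRow-punchIn a m i y

  sgn-*-Π-flip : ∀ n a (y : Fin n → Carrier) → (- 1#) ^ℕ n * Π[ n ] (λ k → a - y k) ≈ Π[ n ] (λ k → y k - a)
  sgn-*-Π-flip zero    a y = *-identityˡ _
  sgn-*-Π-flip (suc n) a y =
    trans (flipFactor (y zero) a ((- 1#) ^ℕ n) _) (*-congˡ (sgn-*-Π-flip n a (y ∘ suc)))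
    where
    flipFactor : ∀ y a p q → (- 1# * p) * ((a - y) * q) ≈ (y - a) * (p * q)
    flipFactor = solve 4 (λ y a p q → (:- con (+ 1) :* p) :* ((a :- y) :* q) := (y :- a) :* (p :* q)) refl

  det-vandermonde : ∀ n (x : Fin n → Carrier) → det n (vandermonde n x) ≈ Π<[ n ] (λ i j → x i - x j)
  det-vandermonde zero    x = refl
  det-vandermonde (suc n) x = *-cancelˡ (sgn-nonzero (fromℕ n)) (begin
    sgn (fromℕ n) * det (suc n) (vandermonde (suc n) x)
      ≈⟨ *-congˡ reduce ⟨
    sgn (fromℕ n) * det (suc n) R
      ≈⟨ det-moveToTop n (fromℕ n) R ⟨
    det (suc n) (λ i j → R (moveToTop (fromℕ n) i) j)
      ≈⟨ expandMovedRow ⟩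
    Π[ n ] (λ k → x (suc k) - a) * Π<[ n ] (λ i j → x (suc i) - x (suc j))
      ≈⟨ *-congʳ (sgn-*-Π-flip n a (x ∘ suc)) ⟨
    ((- 1#) ^ℕ n * Π[ n ] (λ k → a - x (suc k))) * Π<[ n ] (λ i j → x (suc i) - x (suc j))
      ≈⟨ *-assoc _ _ _ ⟩
    (- 1#) ^ℕ n * (Π[ n ] (λ k → a - x (suc k)) * Π<[ n ] (λ i j → x (suc i) - x (suc j)))
      ≈⟨ *-cong (reflexive (≡.cong ((- 1#) ^ℕ_) (Fin.toℕ-fromℕ n))) (Π<-suc n (λ i j → x i - x j)) ⟨
    sgn (fromℕ n) * Π<[ suc n ] (λ i j → x i - x j) ∎)
    where
    a : Carrier
    a = x zero
    R : Matrix (suc n)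
    R r j = reducedRow a n r (x j)
    reduce : det (suc n) R ≈ det (suc n) (vandermonde (suc n) x)
    reduce = begin
      det (suc n) R
        ≈⟨ det-cong (suc n) (λ r j → rowReduction-vandermonde a n r (x j)) ⟨
      det (suc n) (λ r j → Σ[ suc n ] (λ k → rowReduction a r k * vandermonde (suc n) x k j))
        ≈⟨ det-* (suc n) (rowReduction a) (vandermonde (suc n) x) ⟩
      det (suc n) (rowReduction a) * det (suc n) (vandermonde (suc n) x)
        ≈⟨ trans (*-congʳ (det-rowReduction (suc n) a)) (*-identityˡ _) ⟩
      det (suc n) (vandermonde (suc n) x) ∎
    expandMovedRow : det (suc n) (λ i j → R (moveToTop (fromℕ n) i) j)
                     ≈ Π[ n ] (λ k → x (suc k) - a) * Π<[ n ] (λ i j → x (suc i) - x (suc j))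
    expandMovedRow = begin
      det (suc n) (λ i j → R (moveToTop (fromℕ n) i) j)
        ≈⟨ det-firstColumnSparse n (λ i j → R (moveToTop (fromℕ n) i) j) (λ i →
             trans (reflexive (reducedRow-punchIn a n i a)) (trans (*-congˡ (-‿inverseʳ a)) (zeroʳ _))) ⟩
      R (fromℕ n) zero * det n (λ i k → R (punchIn (fromℕ n) i) (suc k))
        ≈⟨ *-cong (reflexive (reducedRow-last a n a))
                  (det-cong n (λ i k → reflexive (reducedRow-punchIn a n i (x (suc k))))) ⟩
      1# * det n (λ i k → vandermonde n (x ∘ suc) i k * (x (suc k) - a))
        ≈⟨ *-identityˡ _ ⟩
      det n (λ i k → vandermonde n (x ∘ suc) i k * (x (suc k) - a))
        ≈⟨ det-scaleCols n (λ k → x (suc k) - a) (vandermonde n (x ∘ suc)) ⟩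
      Π[ n ] (λ k → x (suc k) - a) * det n (vandermonde n (x ∘ suc))
        ≈⟨ *-congˡ (det-vandermonde n (x ∘ suc)) ⟩
      Π[ n ] (λ k → x (suc k) - a) * Π<[ n ] (λ i j → x (suc i) - x (suc j)) ∎

  ^ℕ-homo-+ : ∀ x m n → x ^ℕ (m ℕ.+ n) ≈ x ^ℕ m * x ^ℕ n
  ^ℕ-homo-+ x zero    n = sym (*-identityˡ _)
  ^ℕ-homo-+ x (suc m) n = trans (*-congˡ (^ℕ-homo-+ x m n)) (sym (*-assoc _ _ _))

  ^ℕ-distrib-* : ∀ x y n → (x * y) ^ℕ n ≈ x ^ℕ n * y ^ℕ n
  ^ℕ-distrib-* x y zero    = sym (*-identityˡ _)
  ^ℕ-distrib-* x y (suc n) = trans (*-congˡ (^ℕ-distrib-* x y n)) (interchange _ _ _ _)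

  ^ℕ-inverse : ∀ x → ¬ x ≈ 0# → ∀ n → x ^ℕ n * (x ⁻¹) ^ℕ n ≈ 1#
  ^ℕ-inverse x x≉0 zero    = *-identityˡ _
  ^ℕ-inverse x x≉0 (suc n) =
    trans (interchange _ _ _ _) (trans (*-cong (inverse x x≉0) (^ℕ-inverse x x≉0 n)) (*-identityˡ _))

  ^ℤ-⊖ : ∀ x → ¬ x ≈ 0# → ∀ m n → x ^ℤ (m ⊖ n) ≈ x ^ℕ m * (x ⁻¹) ^ℕ n
  ^ℤ-⊖ x x≉0 zero    zero    = sym (*-identityˡ _)
  ^ℤ-⊖ x x≉0 (suc m) zero    = sym (*-identityʳ _)
  ^ℤ-⊖ x x≉0 zero    (suc n) = sym (*-identityˡ _)
  ^ℤ-⊖ x x≉0 (suc m) (suc n) = begin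
    x ^ℤ (suc m ⊖ suc n)                     ≡⟨ ≡.cong (x ^ℤ_) (ℤ.[1+m]⊖[1+n]≡m⊖n m n) ⟩
    x ^ℤ (m ⊖ n)                             ≈⟨ ^ℤ-⊖ x x≉0 m n ⟩
    x ^ℕ m * (x ⁻¹) ^ℕ n                     ≈⟨ *-identityˡ _ ⟨
    1# * (x ^ℕ m * (x ⁻¹) ^ℕ n)              ≈⟨ *-congʳ (inverse x x≉0) ⟨
    (x * x ⁻¹) * (x ^ℕ m * (x ⁻¹) ^ℕ n)      ≈⟨ interchange _ _ _ _ ⟩
    x ^ℕ suc m * (x ⁻¹) ^ℕ suc n             ∎

  ^ℤ-minus : ∀ x → ¬ x ≈ 0# → ∀ m n → x ^ℤ (+ m ℤ.- + n) ≈ x ^ℕ m * (x ⁻¹) ^ℕ n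
  ^ℤ-minus x x≉0 m n = trans (reflexive (≡.cong (x ^ℤ_) (ℤ.m-n≡m⊖n m n))) (^ℤ-⊖ x x≉0 m n)

  ^ℤ-neg : ∀ x n → x ^ℤ (ℤ- (+ n)) ≈ (x ⁻¹) ^ℕ n
  ^ℤ-neg x zero    = refl
  ^ℤ-neg x (suc n) = refl

  Π-telescope : ∀ n (w : ℕ → Carrier) → (∀ l → l < n → ¬ w l ≈ 0#) →
                Π[ n ] (λ l → w (suc (toℕ l)) * w (toℕ l) ⁻¹) * w 0 ≈ w n
  Π-telescope zero    w w≉0 = *-identityˡ _
  Π-telescope (suc n) w w≉0 = begin
    ((w 1 * w 0 ⁻¹) * rest) * w 0     ≈⟨ regroup (w 1) (w 0 ⁻¹) rest (w 0) ⟩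
    (rest * w 1) * (w 0 ⁻¹ * w 0)     ≈⟨ *-cong (Π-telescope n (w ∘ suc) (λ l l<n → w≉0 (suc l) (ℕ.s≤s l<n)))
                                                (⁻¹-inverseˡ (w 0) (w≉0 0 (ℕ.s≤s ℕ.z≤n))) ⟩
    w (suc n) * 1#                    ≈⟨ *-identityʳ _ ⟩
    w (suc n)                         ∎
    where
    rest : Carrier
    rest = Π[ n ] (λ l → w (suc (suc (toℕ l))) * w (suc (toℕ l)) ⁻¹)
    regroup : ∀ a b p d → ((a * b) * p) * d ≈ (p * a) * (b * d)
    regroup = solve 4 (λ a b p d → ((a :* b) :* p) :* d := (p :* a) :* (b :* d)) refl

  Πℕ : (ℕ → Carrier) → ℕ → Carrier
  Πℕ f zero    = 1#
  Πℕ f (suc n) = f n * Πℕ f n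

  Πℕ-suc : ∀ n (f : ℕ → Carrier) → Πℕ f (suc n) ≈ f 0 * Πℕ (f ∘ suc) n
  Πℕ-suc zero    f = refl
  Πℕ-suc (suc n) f = trans (*-congˡ (Πℕ-suc n f)) (x∙yz≈y∙xz _ _ _)

  Π≈Πℕ : ∀ n (f : ℕ → Carrier) → Π[ n ] (λ r → f (toℕ r)) ≈ Πℕ f n
  Π≈Πℕ zero    f = refl
  Π≈Πℕ (suc n) f = trans (*-congˡ (Π≈Πℕ n (f ∘ suc))) (sym (Πℕ-suc n f))

  Π-reverse : ∀ n (f : ℕ → Carrier) → Π[ n ] (λ r → f (n ∸ suc (toℕ r))) ≈ Π[ n ] (λ r → f (toℕ r))
  Π-reverse n f = trans (reversed n) (sym (Π≈Πℕ n f))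
    where
    reversed : ∀ n → Π[ n ] (λ r → f (n ∸ suc (toℕ r))) ≈ Πℕ f n
    reversed zero    = refl
    reversed (suc n) = *-congˡ (reversed n)

  Πℕ-consecutivePowers : ∀ x n → Πℕ (λ m → x ^ℕ m * x ^ℕ suc m) n ≈ x ^ℕ (n ℕ* n)
  Πℕ-consecutivePowers x zero    = refl
  Πℕ-consecutivePowers x (suc n) = begin
    (x ^ℕ n * x ^ℕ suc n) * Πℕ (λ m → x ^ℕ m * x ^ℕ suc m) n
      ≈⟨ *-congˡ (Πℕ-consecutivePowers x n) ⟩
    (x ^ℕ n * x ^ℕ suc n) * x ^ℕ (n ℕ* n)
      ≈⟨ *-assoc _ _ _ ⟩
    x ^ℕ n * (x ^ℕ suc n * x ^ℕ (n ℕ* n))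
      ≈⟨ trans (^ℕ-homo-+ x n (suc n ℕ+ n ℕ* n)) (*-congˡ (^ℕ-homo-+ x (suc n) (n ℕ* n))) ⟨
    x ^ℕ (n ℕ+ (suc n ℕ+ n ℕ* n))
      ≡⟨ ≡.cong (x ^ℕ_) (≡.trans (ℕ.+-suc n (n ℕ+ n ℕ* n))
                                 (≡.cong (λ t → suc (n ℕ+ t)) (≡.sym (ℕ.*-suc n n)))) ⟩
    x ^ℕ (suc n ℕ* suc n) ∎

  -- The products (s₀ - q z) (s₀ - q² z) ⋯ (s₀ - qᵏ z) and their coefficients

  -- Degrees are listed in decreasing order, matching the rows of vandermonde.
  polyEval : ℕ → (ℕ → Carrier) → Carrier → Carrier
  polyEval n coeff z = Σ[ n ] (λ s → coeff (n ∸ suc (toℕ s)) * z ^ℕ (n ∸ suc (toℕ s)))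

  module QProduct (s₀ q : Carrier) where

    qProduct : ℕ → Carrier → Carrier
    qProduct zero    z = 1#
    qProduct (suc k) z = (s₀ - q ^ℕ suc k * z) * qProduct k z

    qCoeff : ℕ → ℕ → Carrier
    qCoeff zero    zero    = 1#
    qCoeff zero    (suc t) = 0#
    qCoeff (suc k) zero    = s₀ * qCoeff k zero
    qCoeff (suc k) (suc t) = s₀ * qCoeff k (suc t) - q ^ℕ suc k * qCoeff k t

    qCoeff-aboveDegree : ∀ k t → k < t → qCoeff k t ≈ 0#
    qCoeff-aboveDegree zero    (suc t) k<t         = refl
    qCoeff-aboveDegree (suc k) (suc t) (ℕ.s≤s k<t) = begin
      s₀ * qCoeff k (suc t) - q ^ℕ suc k * qCoeff k t
        ≈⟨ +-cong (*-congˡ (qCoeff-aboveDegree k (suc t) (ℕ.m<n⇒m<1+n k<t)))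
                  (-‿cong (*-congˡ (qCoeff-aboveDegree k t k<t))) ⟩
      s₀ * 0# - q ^ℕ suc k * 0#
        ≈⟨ solve 2 (λ s Q → s :* con (+ 0) :- Q :* con (+ 0) := con (+ 0)) refl s₀ (q ^ℕ suc k) ⟩
      0# ∎

    qCoeff-leading-nonzero : ¬ q ≈ 0# → ∀ k → ¬ qCoeff k k ≈ 0#
    qCoeff-leading-nonzero q≉0 zero    = 1≉0
    qCoeff-leading-nonzero q≉0 (suc k) = ≈-nonzero
      (trans (+-congʳ (trans (*-congˡ (qCoeff-aboveDegree k (suc k) ℕ.≤-refl)) (zeroʳ _))) (+-identityˡ _))
      (-‿nonzero (*-nonzero (^ℕ-nonzero (suc k) q≉0) (qCoeff-leading-nonzero q≉0 k)))

    polyEval-qCoeff-suc : ∀ k n z → polyEval (suc n) (qCoeff (suc k)) z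
                          ≈ s₀ * polyEval (suc n) (qCoeff k) z - q ^ℕ suc k * (z * polyEval n (qCoeff k) z)
    polyEval-qCoeff-suc k zero    z =
      solve 4 (λ s c Q z → (s :* c) :* con (+ 1) :+ con (+ 0)
                           := s :* (c :* con (+ 1) :+ con (+ 0)) :- Q :* (z :* con (+ 0)))
        refl s₀ (qCoeff k zero) (q ^ℕ suc k) z
    polyEval-qCoeff-suc k (suc n) z = trans (+-congˡ (polyEval-qCoeff-suc k n z))
      (solve 8 (λ s Q c₁ c₀ z zⁿ E₁ E₀ → (s :* c₁ :- Q :* c₀) :* (z :* zⁿ) :+ (s :* E₁ :- Q :* (z :* E₀))
                    := s :* (c₁ :* (z :* zⁿ) :+ E₁) :- Q :* (z :* (c₀ :* zⁿ :+ E₀))) refl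
         s₀ (q ^ℕ suc k) (qCoeff k (suc n)) (qCoeff k n) z (z ^ℕ n)
         (polyEval (suc n) (qCoeff k) z) (polyEval n (qCoeff k) z))

    polyEval-qCoeff : ∀ k n z → k < n → polyEval n (qCoeff k) z ≈ qProduct k z
    polyEval-qCoeff zero    (suc zero)    z k<n = trans (+-identityʳ _) (*-identityˡ _)
    polyEval-qCoeff zero    (suc (suc n)) z k<n =
      trans (+-cong (zeroˡ _) (polyEval-qCoeff zero (suc n) z (ℕ.s≤s ℕ.z≤n))) (+-identityˡ _)
    polyEval-qCoeff (suc k) (suc n)       z (ℕ.s≤s k<n) = begin
      polyEval (suc n) (qCoeff (suc k)) z
        ≈⟨ polyEval-qCoeff-suc k n z ⟩
      s₀ * polyEval (suc n) (qCoeff k) z - q ^ℕ suc k * (z * polyEval n (qCoeff k) z)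
        ≈⟨ +-cong (*-congˡ (polyEval-qCoeff k (suc n) z (ℕ.m<n⇒m<1+n k<n)))
                  (-‿cong (*-congˡ (*-congˡ (polyEval-qCoeff k n z k<n)))) ⟩
      s₀ * qProduct k z - q ^ℕ suc k * (z * qProduct k z)
        ≈⟨ solve 4 (λ s Q z P → s :* P :- Q :* (z :* P) := (s :- Q :* z) :* P) refl
                   s₀ (q ^ℕ suc k) z (qProduct k z) ⟩
      qProduct (suc k) z ∎

    qProduct-shift : ∀ k z → qProduct (suc k) z ≈ (s₀ - q * z) * qProduct k (q * z)
    qProduct-shift zero    z =
      solve 3 (λ s q z → (s :- (q :* con (+ 1)) :* z) :* con (+ 1) := (s :- q :* z) :* con (+ 1)) refl s₀ q z
    qProduct-shift (suc k) z = trans (*-congˡ (qProduct-shift k z))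
      (solve 5 (λ s q Q z P → (s :- (q :* Q) :* z) :* ((s :- q :* z) :* P)
                            := (s :- q :* z) :* ((s :- Q :* (q :* z)) :* P))
         refl s₀ q (q ^ℕ suc k) z (qProduct k (q * z)))

  bidiagonal : ∀ {n} → (ℕ → Carrier) → (ℕ → Carrier) → Matrix n
  bidiagonal {suc n}       d e zero          zero    = d 0
  bidiagonal {suc n}       d e zero          (suc l) = 0#
  bidiagonal {suc n}       d e (suc r)       (suc l) = bidiagonal (d ∘ ℕ.suc) (e ∘ ℕ.suc) r l
  bidiagonal {suc (suc n)} d e (suc zero)    zero    = e 1
  bidiagonal {suc (suc n)} d e (suc (suc r)) zero    = 0#

  bidiagonal-upper : ∀ {n} d e (i j : Fin n) → i Fin.< j → bidiagonal d e i j ≈ 0#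
  bidiagonal-upper {suc n}       d e zero    (suc j) i<j         = refl
  bidiagonal-upper {suc (suc n)} d e (suc i) (suc j) (ℕ.s≤s i<j) =
    bidiagonal-upper (d ∘ ℕ.suc) (e ∘ ℕ.suc) i j i<j

  bidiagonal-diagonal : ∀ {n} d e (i : Fin n) → bidiagonal d e i i ≈ d (toℕ i)
  bidiagonal-diagonal {suc n}       d e zero    = refl
  bidiagonal-diagonal {suc (suc n)} d e (suc i) = bidiagonal-diagonal (d ∘ ℕ.suc) (e ∘ ℕ.suc) i

  det-bidiagonal : ∀ n d e → det n (bidiagonal d e) ≈ Π[ n ] (λ i → d (toℕ i))
  det-bidiagonal n d e =
    trans (det-lowerTriangular n (bidiagonal d e) (bidiagonal-upper d e)) (Π-cong n (bidiagonal-diagonal d e))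

  bidiagonal-* : ∀ n d e (ζ : ℕ → Carrier) → e 0 ≈ 0# → (r : Fin n) →
                 Σ[ n ] (λ l → bidiagonal d e r l * ζ (toℕ l))
                 ≈ d (toℕ r) * ζ (toℕ r) + e (toℕ r) * ζ (ℕ.pred (toℕ r))
  bidiagonal-* (suc n) d e ζ e0≈0 zero = begin
    d 0 * ζ 0 + Σ[ n ] (λ l → 0# * ζ (suc (toℕ l)))   ≈⟨ +-congˡ (Σ-zero n (λ l → zeroˡ _)) ⟩
    d 0 * ζ 0 + 0#                                    ≈⟨ +-congˡ (trans (*-congʳ e0≈0) (zeroˡ _)) ⟨
    d 0 * ζ 0 + e 0 * ζ 0                             ∎
  bidiagonal-* (suc (suc n)) d e ζ e0≈0 (suc r) =
    trans (shifted n r {d} {e} {ζ}) (+-congˡ (*-congˡ (reflexive (≡.cong ζ (Fin.toℕ-inject₁ r)))))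
    where
    shifted : ∀ n (r : Fin (suc n)) {d e ζ : ℕ → Carrier} →
      Σ[ suc (suc n) ] (λ l → bidiagonal d e (suc r) l * ζ (toℕ l))
      ≈ d (suc (toℕ r)) * ζ (suc (toℕ r)) + e (suc (toℕ r)) * ζ (toℕ (inject₁ r))
    shifted n zero {d} {e} {ζ} = begin
      e 1 * ζ 0 + (d 1 * ζ 1 + Σ[ n ] (λ l → 0# * ζ (suc (suc (toℕ l)))))
        ≈⟨ +-congˡ (trans (+-congˡ (Σ-zero n (λ l → zeroˡ _))) (+-identityʳ _)) ⟩
      e 1 * ζ 0 + d 1 * ζ 1
        ≈⟨ +-comm _ _ ⟩
      d 1 * ζ 1 + e 1 * ζ 0 ∎
    shifted (suc n) (suc r) {d} {e} {ζ} =
      trans (+-cong (zeroˡ _) (shifted n r {d ∘ ℕ.suc} {e ∘ ℕ.suc} {ζ ∘ ℕ.suc})) (+-identityˡ _)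

  -- The matrix of Lemma 4.4 at the geometric point uₗ = qˡ / (s₀ ξ₀ γ)

  module AtGeometricPoint
    (N : ℕ) (q γ s₀ ξ₀ : Carrier) (σ≉0 : ¬ ((s₀ * ξ₀) * γ) ≈ 0#) (q≉0 : ¬ q ≈ 0#)
    (v : Fin N → Carrier) (v-distinct : ∀ i j → i ≢ j → ¬ v i ≈ v j) (v≉0 : ∀ j → ¬ v j ≈ 0#)
    (1-vu≉0 : (j l : Fin N) → ¬ (1# - v j * ((q ^ℕ toℕ l) ÷ ((s₀ * ξ₀) * γ))) ≈ 0#)
    where

    open QProduct s₀ q

    σ : Carrier
    σ = (s₀ * ξ₀) * γ

    u : Fin N → Carrier
    u l = (q ^ℕ toℕ l) ÷ σ

    y : Fin N → Carrier
    y j = v j * ξ₀ ⁻¹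

    ξ₀≉0 : ¬ ξ₀ ≈ 0#
    ξ₀≉0 ξ₀≈0 = σ≉0 (trans (*-congʳ (trans (*-congˡ ξ₀≈0) (zeroʳ _))) (zeroˡ _))

    γs₀σ⁻¹≈ξ₀⁻¹ : (γ * s₀) * σ ⁻¹ ≈ ξ₀ ⁻¹
    γs₀σ⁻¹≈ξ₀⁻¹ = begin
      (γ * s₀) * σ ⁻¹                      ≈⟨ *-congʳ (trans (*-congˡ (inverse ξ₀ ξ₀≉0)) (*-identityʳ _)) ⟨
      ((γ * s₀) * (ξ₀ * ξ₀ ⁻¹)) * σ ⁻¹     ≈⟨ regroup γ s₀ ξ₀ (ξ₀ ⁻¹) (σ ⁻¹) ⟩
      ξ₀ ⁻¹ * (σ * σ ⁻¹)                   ≈⟨ *-congˡ (inverse σ σ≉0) ⟩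
      ξ₀ ⁻¹ * 1#                           ≈⟨ *-identityʳ _ ⟩
      ξ₀ ⁻¹                                ∎
      where
      regroup : ∀ g s x x′ c → ((g * s) * (x * x′)) * c ≈ x′ * (((s * x) * g) * c)
      regroup = solve 5 (λ g s x x′ c → ((g :* s) :* (x :* x′)) :* c := x′ :* (((s :* x) :* g) :* c)) refl

    w : Fin N → ℕ → Carrier
    w j m = 1# - v j * ((q ^ℕ m) ÷ σ)

    w≉0 : ∀ j m → m < N → ¬ w j m ≈ 0#
    w≉0 j m m<N = ≡.subst (λ m → ¬ w j m ≈ 0#) (Fin.toℕ-fromℕ< m<N) (1-vu≉0 j (fromℕ< m<N))

    0<N : Fin N → 0 < N
    0<N zero    = ℕ.s≤s ℕ.z≤n
    0<N (suc _) = ℕ.s≤s ℕ.z≤n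

    Π-ratio≈w : ∀ j → Π[ N ] (λ l → (1# - (q * v j) * u l) ÷ (1# - v j * u l)) ≈ w j N * w j 0 ⁻¹
    Π-ratio≈w j = begin
      Π[ N ] (λ l → (1# - (q * v j) * u l) ÷ (1# - v j * u l))
        ≈⟨ Π-cong N (λ l → *-congʳ (shiftExponent q (v j) (q ^ℕ toℕ l) (σ ⁻¹))) ⟩
      Π[ N ] (λ l → w j (suc (toℕ l)) * w j (toℕ l) ⁻¹)
        ≈⟨ *-identityʳ _ ⟨
      Π[ N ] (λ l → w j (suc (toℕ l)) * w j (toℕ l) ⁻¹) * 1#
        ≈⟨ *-congˡ (inverse (w j 0) (w≉0 j 0 (0<N j))) ⟨
      Π[ N ] (λ l → w j (suc (toℕ l)) * w j (toℕ l) ⁻¹) * (w j 0 * w j 0 ⁻¹)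
        ≈⟨ *-assoc _ _ _ ⟨
      (Π[ N ] (λ l → w j (suc (toℕ l)) * w j (toℕ l) ⁻¹) * w j 0) * w j 0 ⁻¹
        ≈⟨ *-congʳ (Π-telescope N (w j) (w≉0 j)) ⟩
      w j N * w j 0 ⁻¹ ∎
      where
      shiftExponent : ∀ q V Q c → 1# - (q * V) * (Q * c) ≈ 1# - V * ((q * Q) * c)
      shiftExponent = solve 4 (λ q V Q c → con (+ 1) :- (q :* V) :* (Q :* c)
                                         := con (+ 1) :- V :* ((q :* Q) :* c)) refl

    Φ Ψ : Carrier → Carrier
    Φ z = (1# - (γ * s₀) * z) * (q ^ℕ N * z - γ * s₀)
    Ψ z = - ((γ * (1# - s₀ * z)) * (q * z - s₀))

    -- Since v / ξ₀ - γ s₀ = - γ s₀ w 0 and qᴺ v / ξ₀ - γ s₀ = - γ s₀ w N, the telescoped product cancels.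
    brace≈Φ+Ψ : ∀ j Q →
      (((1# - ((γ * s₀) * ξ₀ ⁻¹) * v j) * (v j * ξ₀ ⁻¹ - γ * s₀))
          * Π[ N ] (λ l → (1# - (q * v j) * u l) ÷ (1# - v j * u l)))
        - (((γ * Q) * (1# - (s₀ * ξ₀ ⁻¹) * v j)) * ((q * v j) * ξ₀ ⁻¹ - s₀))
      ≈ Φ (y j) + Q * Ψ (y j)
    brace≈Φ+Ψ j Q = begin
      (a * (V * ξ⁻¹ - g)) * Π[ N ] (λ l → (1# - (q * V) * u l) ÷ (1# - V * u l)) - T
        ≈⟨ +-congʳ (*-cong (*-congˡ first≈) (Π-ratio≈w j)) ⟩
      (a * (- g * w j 0)) * (w j N * w j 0 ⁻¹) - T
        ≈⟨ +-congʳ (regroup a g (w j 0) (w j N) (w j 0 ⁻¹)) ⟩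
      (a * (- g * w j N)) * (w j 0 * w j 0 ⁻¹) - T
        ≈⟨ +-congʳ (trans (*-congˡ (inverse (w j 0) (w≉0 j 0 (0<N j)))) (*-identityʳ _)) ⟩
      a * (- g * w j N) - T
        ≈⟨ +-congʳ (*-congˡ last≈) ⟩
      a * ((q ^ℕ N * V) * ξ⁻¹ - g) - T
        ≈⟨ expand g V ξ⁻¹ (q ^ℕ N) Q γ s₀ q ⟩
      Φ (y j) + Q * Ψ (y j) ∎
      where
      g V ξ⁻¹ a T : Carrier
      g   = γ * s₀
      V   = v j
      ξ⁻¹ = ξ₀ ⁻¹
      a   = 1# - (g * ξ⁻¹) * V
      T   = ((γ * Q) * (1# - (s₀ * ξ⁻¹) * V)) * ((q * V) * ξ⁻¹ - s₀)
      first≈ : V * ξ⁻¹ - g ≈ - g * w j 0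
      first≈ = begin
        V * ξ⁻¹ - g                ≈⟨ +-congʳ (*-congˡ γs₀σ⁻¹≈ξ₀⁻¹) ⟨
        V * (g * σ ⁻¹) - g
          ≈⟨ solve 3 (λ V g c → V :* (g :* c) :- g := :- g :* (con (+ 1) :- V :* (con (+ 1) :* c))) refl V g (σ ⁻¹) ⟩
        - g * w j 0                ∎
      last≈ : - g * w j N ≈ (q ^ℕ N * V) * ξ⁻¹ - g
      last≈ = begin
        - g * w j N
          ≈⟨ solve 4 (λ g V Q c → :- g :* (con (+ 1) :- V :* (Q :* c)) := (Q :* V) :* (g :* c) :- g)
                     refl g V (q ^ℕ N) (σ ⁻¹) ⟩
        (q ^ℕ N * V) * (g * σ ⁻¹) - g   ≈⟨ +-congʳ (*-congˡ γs₀σ⁻¹≈ξ₀⁻¹) ⟩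
        (q ^ℕ N * V) * ξ⁻¹ - g          ∎
      regroup : ∀ a g w₀ wₙ w₀⁻¹ → (a * (- g * w₀)) * (wₙ * w₀⁻¹) ≈ (a * (- g * wₙ)) * (w₀ * w₀⁻¹)
      regroup = solve 5 (λ a g w₀ wₙ w₀⁻¹ → (a :* (:- g :* w₀)) :* (wₙ :* w₀⁻¹)
                                          := (a :* (:- g :* wₙ)) :* (w₀ :* w₀⁻¹)) refl
      expand : ∀ g V e qᴺ Q γ s q →
        (1# - (g * e) * V) * ((qᴺ * V) * e - g) - ((γ * Q) * (1# - (s * e) * V)) * ((q * V) * e - s)
        ≈ (1# - g * (V * e)) * (qᴺ * (V * e) - g) + Q * - ((γ * (1# - s * (V * e))) * (q * (V * e) - s))
      expand = solve 8 (λ g V e qᴺ Q γ s q →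
        (con (+ 1) :- (g :* e) :* V) :* ((qᴺ :* V) :* e :- g)
          :- ((γ :* Q) :* (con (+ 1) :- (s :* e) :* V)) :* ((q :* V) :* e :- s)
        := (con (+ 1) :- g :* (V :* e)) :* (qᴺ :* (V :* e) :- g)
          :+ Q :* (:- ((γ :* (con (+ 1) :- s :* (V :* e))) :* (q :* (V :* e) :- s)))) refl

    deg : Fin N → ℕ
    deg r = N ∸ suc (toℕ r)

    N≡1+r+deg : ∀ r → N ≡ suc (toℕ r) ℕ.+ deg r
    N≡1+r+deg r = ≡.sym (ℕ.m+[n∸m]≡n (Fin.toℕ<n r))

    prefactor : ∀ r j →
      y j * (ξ₀ ^ℤ (+ (2 ℕ* suc (toℕ r)) ℤ.- + N) * v j ^ℤ ((+ N ℤ.- + suc (toℕ r)) ℤ.- + 1))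
      ≈ ξ₀ ^ℕ toℕ r * y j ^ℕ deg r
    prefactor r j = begin
      y j * (ξ₀ ^ℤ (+ (2 ℕ* ι) ℤ.- + N) * V ^ℤ ((+ N ℤ.- + ι) ℤ.- + 1))
        ≈⟨ *-congˡ (*-cong (^ℤ-minus ξ₀ ξ₀≉0 (2 ℕ* ι) N)
                           (trans (reflexive (≡.cong (V ^ℤ_) exponent≡)) (^ℤ-minus V (v≉0 j) N (ι ℕ.+ 1)))) ⟩
      y j * ((ξ₀ ^ℕ (2 ℕ* ι) * e ^ℕ N) * (V ^ℕ N * V⁻¹ ^ℕ (ι ℕ.+ 1)))
        ≈⟨ *-congˡ (*-cong (*-cong ξ^2ι≈ (split e)) (*-cong (split V) (^ℕ-homo-+ V⁻¹ ι 1))) ⟩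
      (V * e) * ((((ξ₀ * ξʳ) * (ξ₀ * ξʳ)) * ((e * eʳ) * eᵈ))
                 * (((V * Vʳ) * Vᵈ) * ((V⁻¹ * V⁻¹ʳ) * (V⁻¹ * 1#))))
        ≈⟨ regroup ξ₀ e ξʳ eʳ eᵈ V V⁻¹ Vʳ V⁻¹ʳ Vᵈ ⟩
      (ξʳ * (Vᵈ * eᵈ)) * (((ξ₀ * e) * (ξ₀ * e)) * (((V * V⁻¹) * (V * V⁻¹)) * ((ξʳ * eʳ) * (Vʳ * V⁻¹ʳ))))
        ≈⟨ *-congˡ units≈1 ⟩
      (ξʳ * (Vᵈ * eᵈ)) * 1#
        ≈⟨ trans (*-identityʳ _) (*-congˡ (sym (^ℕ-distrib-* V e (deg r)))) ⟩
      ξ₀ ^ℕ toℕ r * y j ^ℕ deg r ∎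
      where
      ι : ℕ
      ι = suc (toℕ r)
      V e V⁻¹ ξʳ eʳ eᵈ Vʳ V⁻¹ʳ Vᵈ : Carrier
      V    = v j
      e    = ξ₀ ⁻¹
      V⁻¹  = V ⁻¹
      ξʳ   = ξ₀ ^ℕ toℕ r
      eʳ   = e ^ℕ toℕ r
      eᵈ   = e ^ℕ deg r
      Vʳ   = V ^ℕ toℕ r
      V⁻¹ʳ = V⁻¹ ^ℕ toℕ r
      Vᵈ   = V ^ℕ deg r
      exponent≡ : (+ N ℤ.- + ι) ℤ.- + 1 ≡ + N ℤ.- + (ι ℕ.+ 1)
      exponent≡ = ≡.trans (ℤ.+-assoc (+ N) (ℤ- + ι) (ℤ- + 1))
                          (≡.cong (λ t → + N ℤ.+ t) (≡.sym (ℤ.neg-distrib-+ (+ ι) (+ 1))))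
      split : ∀ x → x ^ℕ N ≈ (x * x ^ℕ toℕ r) * x ^ℕ deg r
      split x = trans (reflexive (≡.cong (x ^ℕ_) (N≡1+r+deg r))) (^ℕ-homo-+ x ι (deg r))
      ξ^2ι≈ : ξ₀ ^ℕ (2 ℕ* ι) ≈ (ξ₀ * ξʳ) * (ξ₀ * ξʳ)
      ξ^2ι≈ = trans (^ℕ-homo-+ ξ₀ ι (ι ℕ.+ 0)) (*-congˡ (reflexive (≡.cong (ξ₀ ^ℕ_) (ℕ.+-identityʳ ι))))
      regroup : ∀ x e xʳ eʳ eᵈ w w′ wʳ w′ʳ wᵈ →
        (w * e) * ((((x * xʳ) * (x * xʳ)) * ((e * eʳ) * eᵈ)) * (((w * wʳ) * wᵈ) * ((w′ * w′ʳ) * (w′ * 1#))))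
        ≈ (xʳ * (wᵈ * eᵈ)) * (((x * e) * (x * e)) * (((w * w′) * (w * w′)) * ((xʳ * eʳ) * (wʳ * w′ʳ))))
      regroup = solve 10 (λ x e xʳ eʳ eᵈ w w′ wʳ w′ʳ wᵈ →
        (w :* e) :* ((((x :* xʳ) :* (x :* xʳ)) :* ((e :* eʳ) :* eᵈ))
                     :* (((w :* wʳ) :* wᵈ) :* ((w′ :* w′ʳ) :* (w′ :* con (+ 1)))))
        := (xʳ :* (wᵈ :* eᵈ)) :* (((x :* e) :* (x :* e))
                                  :* (((w :* w′) :* (w :* w′)) :* ((xʳ :* eʳ) :* (wʳ :* w′ʳ))))) refl
      units≈1 : ((ξ₀ * e) * (ξ₀ * e)) * (((V * V⁻¹) * (V * V⁻¹)) * ((ξʳ * eʳ) * (Vʳ * V⁻¹ʳ))) ≈ 1#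
      units≈1 = begin
        ((ξ₀ * e) * (ξ₀ * e)) * (((V * V⁻¹) * (V * V⁻¹)) * ((ξʳ * eʳ) * (Vʳ * V⁻¹ʳ)))
          ≈⟨ *-cong (*-cong ξe≈1 ξe≈1) (*-cong (*-cong VV⁻¹≈1 VV⁻¹≈1)
                    (*-cong (^ℕ-inverse ξ₀ ξ₀≉0 (toℕ r)) (^ℕ-inverse V (v≉0 j) (toℕ r)))) ⟩
        (1# * 1#) * ((1# * 1#) * (1# * 1#))
          ≈⟨ trans (*-cong (*-identityˡ 1#) (trans (*-cong (*-identityˡ 1#) (*-identityˡ 1#)) (*-identityˡ 1#)))
                   (*-identityˡ 1#) ⟩
        1# ∎
        where
        ξe≈1 : ξ₀ * e ≈ 1#
        ξe≈1 = inverse ξ₀ ξ₀≉0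
        VV⁻¹≈1 : V * V⁻¹ ≈ 1#
        VV⁻¹≈1 = inverse V (v≉0 j)

    reduced : Matrix N
    reduced r j = y j ^ℕ deg r * (Φ (y j) + q ^ℕ deg r * Ψ (y j))

    scaledEntry : ∀ r j → y j * M N q γ s₀ ξ₀ u r (v j) ≈ ξ₀ ^ℕ toℕ r * reduced r j
    scaledEntry r j = trans (sym (*-assoc _ _ _)) (trans (*-cong (prefactor r j) (brace≈Φ+Ψ j (q ^ℕ deg r))) (*-assoc _ _ _))

    U : Matrix N
    U r s = qCoeff (deg r) (deg s)

    det-U≉0 : ¬ det N U ≈ 0#
    det-U≉0 = ≈-nonzero (det-upperTriangular N U lower≈0) (Π-nonzero N (λ r → qCoeff-leading-nonzero q≉0 (deg r)))
      where
      lower≈0 : ∀ r s → s Fin.< r → U r s ≈ 0#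
      lower≈0 r s s<r = qCoeff-aboveDegree (deg r) (deg s) (ℕ.∸-monoʳ-< (ℕ.s≤s s<r) (Fin.toℕ<n r))

    U-reduced : ∀ r j → Σ[ N ] (λ s → U r s * reduced s j)
                        ≈ Φ (y j) * polyEval N (qCoeff (deg r)) (y j) + Ψ (y j) * polyEval N (qCoeff (deg r)) (q * y j)
    U-reduced r j = begin
      Σ[ N ] (λ s → U r s * reduced s j)
        ≈⟨ Σ-cong N (λ s → splitTerm (U r s) (deg s) (y j)) ⟩
      Σ[ N ] (λ s → Φ (y j) * f s + Ψ (y j) * g s)
        ≈⟨ Σ-distrib-+ N (λ s → Φ (y j) * f s) (λ s → Ψ (y j) * g s) ⟩
      Σ[ N ] (λ s → Φ (y j) * f s) + Σ[ N ] (λ s → Ψ (y j) * g s)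
        ≈⟨ +-cong (*-distribˡ-Σ N (Φ (y j)) f) (*-distribˡ-Σ N (Ψ (y j)) g) ⟨
      Φ (y j) * polyEval N (qCoeff (deg r)) (y j) + Ψ (y j) * polyEval N (qCoeff (deg r)) (q * y j) ∎
      where
      f g : Fin N → Carrier
      f s = U r s * y j ^ℕ deg s
      g s = U r s * (q * y j) ^ℕ deg s
      splitTerm : ∀ c m z → c * (z ^ℕ m * (Φ z + q ^ℕ m * Ψ z)) ≈ Φ z * (c * z ^ℕ m) + Ψ z * (c * (q * z) ^ℕ m)
      splitTerm c m z = trans
        (solve 5 (λ c zᵐ F qᵐ G → c :* (zᵐ :* (F :+ qᵐ :* G)) := F :* (c :* zᵐ) :+ G :* (c :* (qᵐ :* zᵐ))) refl
           c (z ^ℕ m) (Φ z) (q ^ℕ m) (Ψ z))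
        (+-congˡ (*-congˡ (*-congˡ (sym (^ℕ-distrib-* q z m)))))

    μ ν : ℕ → Carrier
    μ m = (q ^ℕ suc (N ∸ suc m) - (γ * s₀) * s₀) * (q ^ℕ m - γ)
    ν m = - ((γ * s₀) * (1# - q ^ℕ m))

    ν0≈0 : ν 0 ≈ 0#
    ν0≈0 = solve 2 (λ g s → :- ((g :* s) :* (con (+ 1) :- con (+ 1))) := con (+ 0)) refl γ s₀

    -- With k = N - 1 - m, the identity q^N = q^(k+1) q^m lets Φ and Ψ recombine into μ m and ν m.
    Φ-Ψ-recurrence : ∀ m → m < N → ∀ z →
      Φ z * qProduct (N ∸ suc m) z + Ψ z * qProduct (N ∸ suc m) (q * z)
      ≈ (μ m * qProduct (N ∸ suc m) z + ν m * qProduct (suc (N ∸ suc m)) z) * z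
    Φ-Ψ-recurrence m m<N z = begin
      Φ z * P + Ψ z * qProduct k (q * z)
        ≈⟨ +-congˡ (trans (moveFactor γ s₀ q z (qProduct k (q * z))) (*-congˡ (sym (qProduct-shift k z)))) ⟩
      Φ z * P + (γ * (1# - s₀ * z)) * ((s₀ - K * z) * P)
        ≈⟨ +-congʳ (*-congʳ (*-congˡ (+-congʳ (*-congʳ qᴺ≈KR)))) ⟩
      ((1# - (γ * s₀) * z) * ((K * R) * z - γ * s₀)) * P + (γ * (1# - s₀ * z)) * ((s₀ - K * z) * P)
        ≈⟨ recombine z s₀ γ K R P ⟩
      (μ m * P + ν m * ((s₀ - K * z) * P)) * z ∎
      where
      k : ℕ
      k = N ∸ suc m
      K R P : Carrier
      K = q ^ℕ suc k
      R = q ^ℕ m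
      P = qProduct k z
      qᴺ≈KR : q ^ℕ N ≈ K * R
      qᴺ≈KR = trans (reflexive (≡.cong (q ^ℕ_) N≡)) (^ℕ-homo-+ q (suc k) m)
        where
        N≡ : N ≡ suc k ℕ.+ m
        N≡ = ≡.sym (≡.trans (≡.sym (ℕ.+-suc k m)) (ℕ.m∸n+n≡m m<N))
      moveFactor : ∀ g s q z P → (- ((g * (1# - s * z)) * (q * z - s))) * P ≈ (g * (1# - s * z)) * ((s - q * z) * P)
      moveFactor = solve 5 (λ g s q z P → (:- ((g :* (con (+ 1) :- s :* z)) :* (q :* z :- s))) :* P
                                        := (g :* (con (+ 1) :- s :* z)) :* ((s :- q :* z) :* P)) refl
      recombine : ∀ z s g K R P →
        ((1# - (g * s) * z) * ((K * R) * z - g * s)) * P + (g * (1# - s * z)) * ((s - K * z) * P)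
        ≈ (((K - (g * s) * s) * (R - g)) * P + (- ((g * s) * (1# - R))) * ((s - K * z) * P)) * z
      recombine = solve 6 (λ z s g K R P →
        ((con (+ 1) :- (g :* s) :* z) :* ((K :* R) :* z :- g :* s)) :* P :+ (g :* (con (+ 1) :- s :* z)) :* ((s :- K :* z) :* P)
        := (((K :- (g :* s) :* s) :* (R :- g)) :* P :+ (:- ((g :* s) :* (con (+ 1) :- R))) :* ((s :- K :* z) :* P)) :* z) refl

    UV : Matrix N
    UV l j = Σ[ N ] (λ s → U l s * vandermonde N y s j)

    ζ : Fin N → ℕ → Carrier
    ζ j m = polyEval N (qCoeff (N ∸ suc m)) (y j)

    ∸suc<N : ∀ m → m < N → N ∸ suc m < N
    ∸suc<N m m<N = ℕ.∸-monoʳ-< (ℕ.s≤s ℕ.z≤n) m<N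

    ζ≈qProduct : ∀ j m → m < N → ζ j m ≈ qProduct (N ∸ suc m) (y j)
    ζ≈qProduct j m m<N = polyEval-qCoeff (N ∸ suc m) N (y j) (∸suc<N m m<N)

    ν-ζ-pred : ∀ j m → m < N → ν m * ζ j (ℕ.pred m) ≈ ν m * qProduct (suc (N ∸ suc m)) (y j)
    ν-ζ-pred j zero    _   = trans (*-congʳ ν0≈0) (trans (zeroˡ _) (sym (trans (*-congʳ ν0≈0) (zeroˡ _))))
    ν-ζ-pred j (suc m) m<N = *-congˡ (begin
      polyEval N (qCoeff (N ∸ suc m)) (y j)
        ≡⟨ ≡.cong (λ t → polyEval N (qCoeff t) (y j)) N∸m≡ ⟩
      polyEval N (qCoeff (suc (N ∸ suc (suc m)))) (y j)
        ≈⟨ polyEval-qCoeff (suc (N ∸ suc (suc m))) N (y j) (≡.subst (_< N) N∸m≡ (∸suc<N m (ℕ.<⇒≤ m<N))) ⟩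
      qProduct (suc (N ∸ suc (suc m))) (y j) ∎)
      where
      N∸m≡ : N ∸ suc m ≡ suc (N ∸ suc (suc m))
      N∸m≡ = ℕ.+-∸-assoc 1 m<N

    U-reduced≈bidiagonal-UV : ∀ r j → Σ[ N ] (λ s → U r s * reduced s j)
                                      ≈ Σ[ N ] (λ l → bidiagonal μ ν r l * UV l j) * y j
    U-reduced≈bidiagonal-UV r j = begin
      Σ[ N ] (λ s → U r s * reduced s j)
        ≈⟨ U-reduced r j ⟩
      Φ (y j) * polyEval N (qCoeff k) (y j) + Ψ (y j) * polyEval N (qCoeff k) (q * y j)
        ≈⟨ +-cong (*-congˡ (ζ≈qProduct j m r<N)) (*-congˡ (polyEval-qCoeff k N (q * y j) (∸suc<N m r<N))) ⟩
      Φ (y j) * qProduct k (y j) + Ψ (y j) * qProduct k (q * y j)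
        ≈⟨ Φ-Ψ-recurrence m r<N (y j) ⟩
      (μ m * qProduct k (y j) + ν m * qProduct (suc k) (y j)) * y j
        ≈⟨ *-congʳ (+-cong (*-congˡ (ζ≈qProduct j m r<N)) (ν-ζ-pred j m r<N)) ⟨
      (μ m * ζ j m + ν m * ζ j (ℕ.pred m)) * y j
        ≈⟨ *-congʳ (bidiagonal-* N μ ν (ζ j) ν0≈0 r) ⟨
      Σ[ N ] (λ l → bidiagonal μ ν r l * UV l j) * y j ∎
      where
      m k : ℕ
      m = toℕ r
      k = deg r
      r<N : m < N
      r<N = Fin.toℕ<n r

    A : Matrix N
    A r j = M N q γ s₀ ξ₀ u r (v j)

    Δ : (Fin N → Carrier) → Carrier
    Δ x = Π<[ N ] (λ i j → x i - x j)

    y≉0 : ∀ j → ¬ y j ≈ 0#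
    y≉0 j = *-nonzero (v≉0 j) (⁻¹-nonzero ξ₀≉0)

    Δv≉0 : ¬ Δ v ≈ 0#
    Δv≉0 = Π<-nonzero N (λ i j → v i - v j) (λ i j i≢j vi-vj≈0 → v-distinct i j i≢j (begin
      v i                   ≈⟨ +-identityʳ _ ⟨
      v i + 0#              ≈⟨ +-congˡ (-‿inverseˡ (v j)) ⟨
      v i + (- v j + v j)   ≈⟨ +-assoc _ _ _ ⟨
      (v i - v j) + v j     ≈⟨ +-congʳ vi-vj≈0 ⟩
      0# + v j              ≈⟨ +-identityˡ _ ⟩
      v j                   ∎))

    Πξʳ*Δy≈Δv : Π[ N ] (λ r → ξ₀ ^ℕ toℕ r) * Δ y ≈ Δ v
    Πξʳ*Δy≈Δv = begin
      Πξʳ * Δ y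
        ≈⟨ *-congˡ (Π<-cong N (λ i j → factor (v i) (v j) (ξ₀ ⁻¹))) ⟩
      Πξʳ * Π<[ N ] (λ i j → (v i - v j) * ξ₀ ⁻¹)
        ≈⟨ *-congˡ (Π<-distrib-* N (λ i j → v i - v j) (λ _ _ → ξ₀ ⁻¹)) ⟩
      Πξʳ * (Δ v * Π<[ N ] (λ _ _ → ξ₀ ⁻¹))
        ≈⟨ x∙yz≈y∙xz _ _ _ ⟩
      Δ v * (Πξʳ * Π<[ N ] (λ _ _ → ξ₀ ⁻¹))
        ≈⟨ *-congˡ (Π-powers-cancel-Π< N ξ₀ (ξ₀ ⁻¹) (inverse ξ₀ ξ₀≉0)) ⟩
      Δ v * 1#
        ≈⟨ *-identityʳ _ ⟩
      Δ v ∎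
      where
      Πξʳ : Carrier
      Πξʳ = Π[ N ] (λ r → ξ₀ ^ℕ toℕ r)
      factor : ∀ a b e → a * e - b * e ≈ (a - b) * e
      factor = solve 3 (λ a b e → a :* e :- b :* e := (a :- b) :* e) refl

    det-A-scaled : Π[ N ] y * det N A ≈ Π[ N ] (λ r → ξ₀ ^ℕ toℕ r) * det N reduced
    det-A-scaled = begin
      Π[ N ] y * det N A                             ≈⟨ det-scaleCols N y A ⟨
      det N (λ i j → A i j * y j)                    ≈⟨ det-cong N (λ i j → trans (*-comm _ _) (scaledEntry i j)) ⟩
      det N (λ i j → ξ₀ ^ℕ toℕ i * reduced i j)      ≈⟨ det-scaleRows N (λ i → ξ₀ ^ℕ toℕ i) reduced ⟩
      Π[ N ] (λ r → ξ₀ ^ℕ toℕ r) * det N reduced     ∎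

    det-U-reduced : det N U * det N reduced
                    ≈ Π[ N ] y * (det N (bidiagonal μ ν) * (det N U * det N (vandermonde N y)))
    det-U-reduced = begin
      det N U * det N reduced
        ≈⟨ det-* N U reduced ⟨
      det N (λ r j → Σ[ N ] (λ s → U r s * reduced s j))
        ≈⟨ det-cong N U-reduced≈bidiagonal-UV ⟩
      det N (λ r j → Σ[ N ] (λ l → bidiagonal μ ν r l * UV l j) * y j)
        ≈⟨ det-scaleCols N y (λ r j → Σ[ N ] (λ l → bidiagonal μ ν r l * UV l j)) ⟩
      Π[ N ] y * det N (λ r j → Σ[ N ] (λ l → bidiagonal μ ν r l * UV l j))
        ≈⟨ *-congˡ (det-* N (bidiagonal μ ν) UV) ⟩
      Π[ N ] y * (det N (bidiagonal μ ν) * det N UV)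
        ≈⟨ *-congˡ (*-congˡ (det-* N U (vandermonde N y))) ⟩
      Π[ N ] y * (det N (bidiagonal μ ν) * (det N U * det N (vandermonde N y))) ∎

    det-A : det N A ≈ det N (bidiagonal μ ν) * Δ v
    det-A = begin
      det N A                 ≈⟨ *-cancelˡ (*-nonzero det-U≉0 (Π-nonzero N y≉0)) cancelled ⟩
      (Πξʳ * B) * det N VM    ≈⟨ *-congˡ (det-vandermonde N y) ⟩
      (Πξʳ * B) * Δ y         ≈⟨ xy∙z≈y∙xz _ _ _ ⟩
      B * (Πξʳ * Δ y)         ≈⟨ *-congˡ Πξʳ*Δy≈Δv ⟩
      B * Δ v                 ∎
      where
      Πξʳ B : Carrier
      Πξʳ = Π[ N ] (λ r → ξ₀ ^ℕ toℕ r)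
      B   = det N (bidiagonal μ ν)
      VM : Matrix N
      VM = vandermonde N y
      cancelled : (det N U * Π[ N ] y) * det N A ≈ (det N U * Π[ N ] y) * ((Πξʳ * B) * det N VM)
      cancelled = begin
        (det N U * Π[ N ] y) * det N A                  ≈⟨ *-assoc _ _ _ ⟩
        det N U * (Π[ N ] y * det N A)                  ≈⟨ *-congˡ det-A-scaled ⟩
        det N U * (Πξʳ * det N reduced)                 ≈⟨ x∙yz≈y∙xz _ _ _ ⟩
        Πξʳ * (det N U * det N reduced)                 ≈⟨ *-congˡ det-U-reduced ⟩
        Πξʳ * (Π[ N ] y * (B * (det N U * det N VM)))   ≈⟨ regroup Πξʳ (Π[ N ] y) B (det N U) (det N VM) ⟩
        (det N U * Π[ N ] y) * ((Πξʳ * B) * det N VM)   ∎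
        where
        regroup : ∀ x p b d w → x * (p * (b * (d * w))) ≈ (d * p) * ((x * b) * w)
        regroup = solve 5 (λ x p b d w → x :* (p :* (b :* (d :* w))) := (d :* p) :* ((x :* b) :* w)) refl

    normalisedFactor : Fin N → Carrier
    normalisedFactor j = (1# - γ * q ^ℤ (ℤ- (+ toℕ j))) * (1# - ((s₀ * s₀) * γ) * q ^ℤ (ℤ- (+ (toℕ j ℕ+ 1))))

    Π-μ : Π[ N ] (λ r → μ (toℕ r)) ≈ q ^ℕ (N ℕ* N) * Π[ N ] normalisedFactor
    Π-μ = begin
      Π[ N ] (λ r → μ (toℕ r))
        ≈⟨ Π-distrib-* N (λ r → q ^ℕ suc (deg r) - g′) (λ r → q ^ℕ toℕ r - γ) ⟩
      Π[ N ] (λ r → q ^ℕ suc (deg r) - g′) * Π[ N ] (λ r → q ^ℕ toℕ r - γ)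
        ≈⟨ *-congʳ (Π-reverse N (λ m → q ^ℕ suc m - g′)) ⟩
      Π[ N ] (λ r → q ^ℕ suc (toℕ r) - g′) * Π[ N ] (λ r → q ^ℕ toℕ r - γ)
        ≈⟨ *-comm _ _ ⟩
      Π[ N ] (λ r → q ^ℕ toℕ r - γ) * Π[ N ] (λ r → q ^ℕ suc (toℕ r) - g′)
        ≈⟨ Π-distrib-* N _ _ ⟨
      Π[ N ] (λ r → (q ^ℕ toℕ r - γ) * (q ^ℕ suc (toℕ r) - g′))
        ≈⟨ Π-cong N factorPowers ⟩
      Π[ N ] (λ r → (q ^ℕ toℕ r * q ^ℕ suc (toℕ r)) * normalisedFactor r)
        ≈⟨ Π-distrib-* N _ normalisedFactor ⟩
      Π[ N ] (λ r → q ^ℕ toℕ r * q ^ℕ suc (toℕ r)) * Π[ N ] normalisedFactor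
        ≈⟨ *-congʳ (trans (Π≈Πℕ N (λ m → q ^ℕ m * q ^ℕ suc m)) (Πℕ-consecutivePowers q N)) ⟩
      q ^ℕ (N ℕ* N) * Π[ N ] normalisedFactor ∎
      where
      g′ : Carrier
      g′ = (γ * s₀) * s₀
      factorPowers : ∀ r → (q ^ℕ toℕ r - γ) * (q ^ℕ suc (toℕ r) - g′)
                           ≈ (q ^ℕ toℕ r * q ^ℕ suc (toℕ r)) * normalisedFactor r
      factorPowers r = sym (begin
        (Q₁ * Q₂) * normalisedFactor r
          ≈⟨ *-congˡ (*-cong (+-congˡ (-‿cong (*-congˡ (^ℤ-neg q m))))
                             (+-congˡ (-‿cong (*-congˡ (trans (reflexive (≡.cong (λ t → q ^ℤ (ℤ- (+ t))) (ℕ.+-comm m 1)))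
                                                               (^ℤ-neg q (suc m))))))) ⟩
        (Q₁ * Q₂) * ((1# - γ * I₁) * (1# - ((s₀ * s₀) * γ) * I₂))
          ≈⟨ distribute Q₁ Q₂ I₁ I₂ γ s₀ ⟩
        (Q₁ - γ * (Q₁ * I₁)) * (Q₂ - g′ * (Q₂ * I₂))
          ≈⟨ *-cong (+-congˡ (-‿cong (trans (*-congˡ (^ℕ-inverse q q≉0 m)) (*-identityʳ _))))
                    (+-congˡ (-‿cong (trans (*-congˡ (^ℕ-inverse q q≉0 (suc m))) (*-identityʳ _)))) ⟩
        (Q₁ - γ) * (Q₂ - g′) ∎)
        where
        m : ℕ
        m = toℕ r
        Q₁ Q₂ I₁ I₂ : Carrier
        Q₁ = q ^ℕ m
        Q₂ = q ^ℕ suc m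
        I₁ = (q ⁻¹) ^ℕ m
        I₂ = (q ⁻¹) ^ℕ suc m
        distribute : ∀ Q₁ Q₂ I₁ I₂ g s → (Q₁ * Q₂) * ((1# - g * I₁) * (1# - ((s * s) * g) * I₂))
                                         ≈ (Q₁ - g * (Q₁ * I₁)) * (Q₂ - ((g * s) * s) * (Q₂ * I₂))
        distribute = solve 6 (λ Q₁ Q₂ I₁ I₂ g s →
          (Q₁ :* Q₂) :* ((con (+ 1) :- g :* I₁) :* (con (+ 1) :- ((s :* s) :* g) :* I₂))
          := (Q₁ :- g :* (Q₁ :* I₁)) :* (Q₂ :- ((g :* s) :* s) :* (Q₂ :* I₂))) refl

    Π-1-uv≈Π-1-vu : (Π[ N ] λ i → Π[ N ] λ j → 1# - u i * v j) ≈ (Π[ N ] λ i → Π[ N ] λ j → 1# - v i * u j)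
    Π-1-uv≈Π-1-vu = trans (Π-comm N N (λ i j → 1# - u i * v j))
                          (Π-cong N (λ j → Π-cong N (λ i → +-congˡ (-‿cong (*-comm (u i) (v j))))))

lemma4p4 : ∀ {c ℓ : Level} (F : Field c ℓ) → let open FieldDefs F in
    (N : ℕ) → 1 ≤ N →
    (q γ s₀ ξ₀ : Carrier) → ¬ (((s₀ * ξ₀) * γ) ≈ 0#) → ¬ (q ≈ 0#) →
    (v : Fin N → Carrier) →
    (∀ i j → i ≢ j → ¬ (v i ≈ v j)) →
    (∀ j → ¬ (v j ≈ 0#)) →
    ((j l : Fin N) → ¬ ((1# - v j * ((q ^ℕ toℕ l) ÷ ((s₀ * ξ₀) * γ))) ≈ 0#)) →
    𝓜 N q γ s₀ ξ₀ (λ l → (q ^ℕ toℕ l) ÷ ((s₀ * ξ₀) * γ)) v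
    ≈ (((q ^ℕ (N ℕ* N))
        * (Π[ N ] λ i → Π[ N ] λ j →
                   1# - v i * ((q ^ℕ toℕ j) ÷ ((s₀ * ξ₀) * γ))))
        * (Π[ N ] λ j →
                   (1# - γ * (q ^ℤ (ℤ- (+ toℕ j))))
                   * (1# - ((s₀ * s₀) * γ) * (q ^ℤ (ℤ- (+ (toℕ j ℕ+ 1)))))))
lemma4p4 F N _ q γ s₀ ξ₀ σ≉0 q≉0 v v-distinct v≉0 1-vu≉0 = begin
  Π-uv * (det N A ÷ Δ v)                     ≈⟨ *-congˡ (*-congʳ det-A) ⟩
  Π-uv * ((det N B * Δ v) ÷ Δ v)             ≈⟨ *-congˡ (*-÷-cancelʳ F (det N B) Δv≉0) ⟩
  Π-uv * det N B                             ≈⟨ *-cong Π-1-uv≈Π-1-vu (trans (det-bidiagonal F N μ ν) Π-μ) ⟩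
  Π-vu * (q ^ℕ (N ℕ* N) * Π[ N ] normalisedFactor)
                                             ≈⟨ x∙yz≈y∙xz _ _ _ ⟩
  q ^ℕ (N ℕ* N) * (Π-vu * Π[ N ] normalisedFactor)
                                             ≈⟨ *-assoc _ _ _ ⟨
  (q ^ℕ (N ℕ* N) * Π-vu) * Π[ N ] normalisedFactor ∎
  where
  open FieldDefs F
  open AtGeometricPoint F N q γ s₀ ξ₀ σ≉0 q≉0 v v-distinct v≉0 1-vu≉0
  open import Algebra.Properties.CommutativeSemigroup *-commutativeSemigroup using (x∙yz≈y∙xz)
  open import Relation.Binary.Reasoning.Setoid setoid
  B : Matrix F N
  B = bidiagonal F μ ν
  Π-uv Π-vu : Carrier
  Π-uv = Π[ N ] λ i → Π[ N ] λ j → 1# - u i * v j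
  Π-vu = Π[ N ] λ i → Π[ N ] λ j → 1# - v i * u j
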